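{- Let $G=(V,E)$ be a finite simple graph and let $\lambda\in\mathbb{Z}_{>0}^V$. There exists a unique polynomial $\widetilde{\chi}_G^\lambda(q,x)\in\mathbb{Q}(q)[x]$ such that \[ \widetilde{\chi}_G^\lambda(q,[n]_q) \;=\; \chi_G^\lambda(q,n)\qquad\text{for all } n\in\mathbb{Z}_{>0}, \] where $[n]_q:=\frac{1-q^n}{1-q}$.
   Context: For a positive integer $n$, $[n]=\{1,\dots,n\}$. A coloring $c:V\to[n]$ is proper if $c(v)\neq c(w)$ whenever $vw\in E$. The $q$-chromatic function is \[ \chi_G^\lambda(q,n):=\sum_{\substack{\text{proper colorings}\\ c:V\to[n]}} q^{\sum_{v\in V}\lambda_v c(v)} . \] -}

module Defs where

open import Data.Nat as ℕ using (ℕ; zero; suc)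
open import Data.Bool using (Bool; true; false; not; _∨_; if_then_else_)
open import Data.Fin using (Fin; toℕ; _≟_)
open import Data.List using (List; []; _∷_; map; foldr; allFin; concatMap; replicate; _++_)
open import Data.Nat.ListAction using (sum)
open import Data.Bool.ListAction using (all)
open import Data.Rational as ℚ using (ℚ; 0ℚ; 1ℚ)
open import Data.Vec.Functional using (Vector) renaming (_∷_ to _∷ᵥ_)
open import Relation.Nullary using (¬_)
open import Relation.Nullary.Decidable using (⌊_⌋)
open import Relation.Binary.PropositionalEquality using (_≡_)

-- Polynomials in q over ℚ: coefficient lists, lowest degree first.

PolyQ : Set
PolyQ = List ℚ

coeffQ : PolyQ → ℕ → ℚ
coeffQ []      _       = 0ℚ
coeffQ (a ∷ p) zero    = a
coeffQ (a ∷ p) (suc i) = coeffQ p i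

-- equality of polynomials: all coefficients agree (trailing zeros ignored)
_≈P_ : PolyQ → PolyQ → Set
p ≈P r = ∀ i → coeffQ p i ≡ coeffQ r i

infixl 6 _+P_
infixl 7 _*P_

_+P_ : PolyQ → PolyQ → PolyQ
[]      +P r       = r
(a ∷ p) +P []      = a ∷ p
(a ∷ p) +P (b ∷ r) = (a ℚ.+ b) ∷ (p +P r)

scaleP : ℚ → PolyQ → PolyQ
scaleP a = map (a ℚ.*_)

_*P_ : PolyQ → PolyQ → PolyQ
[]      *P r = []
(a ∷ p) *P r = scaleP a r +P (0ℚ ∷ (p *P r))

negP : PolyQ → PolyQ
negP = map (λ a → ℚ.- a)

qPow : ℕ → PolyQ
qPow k = replicate k 0ℚ ++ (1ℚ ∷ [])

-- The field ℚ(q) of rational functions, as fractions num/den of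
-- polynomials in ℚ[q]; a fraction is valid when den ≠ 0, and two
-- fractions are equal when num₁·den₂ = num₂·den₁.

record RatFun : Set where
  constructor _/_
  field
    num : PolyQ
    den : PolyQ
open RatFun public

ValidF : RatFun → Set
ValidF f = ¬ (den f ≈P [])

_≈F_ : RatFun → RatFun → Set
f ≈F g = (num f *P den g) ≈P (num g *P den f)

0F : RatFun
0F = [] / (1ℚ ∷ [])

fromPolyQ : PolyQ → RatFun
fromPolyQ p = p / (1ℚ ∷ [])

_+F_ : RatFun → RatFun → RatFun
f +F g = (num f *P den g +P num g *P den f) / (den f *P den g)

_*F_ : RatFun → RatFun → RatFun
f *F g = (num f *P num g) / (den f *P den g)

qInt : ℕ → RatFun
qInt n = ((1ℚ ∷ []) +P negP (qPow n)) / (1ℚ ∷ (ℚ.- 1ℚ) ∷ [])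

-- Polynomials in x over ℚ(q): coefficient lists, lowest degree first.

PolyF : Set
PolyF = List RatFun

coeffF : PolyF → ℕ → RatFun
coeffF []      _       = 0F
coeffF (a ∷ p) zero    = a
coeffF (a ∷ p) (suc i) = coeffF p i

_≈PF_ : PolyF → PolyF → Set
P ≈PF Q = ∀ i → coeffF P i ≈F coeffF Q i

evalF : PolyF → RatFun → RatFun
evalF []      x = 0F
evalF (a ∷ P) x = a +F (x *F evalF P x)

record SimpleGraph (v : ℕ) : Set where
  field
    adj    : Fin v → Fin v → Bool
    sym    : ∀ i j → adj i j ≡ adj j i
    irrefl : ∀ i → adj i i ≡ false
open SimpleGraph public

-- all maps Fin v → Fin n (color c ∈ Fin n stands for color toℕ c + 1 ∈ [n])
colorings : (v n : ℕ) → List (Fin v → Fin n)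
colorings zero    n = (λ ()) ∷ []
colorings (suc v) n =
  concatMap (λ c → map (λ i → i ∷ᵥ c) (allFin n)) (colorings v n)

isProper : ∀ {v n} → SimpleGraph v → (Fin v → Fin n) → Bool
isProper {v} G c =
  all (λ i → all (λ j → not (adj G i j) ∨ not ⌊ c i ≟ c j ⌋) (allFin v)) (allFin v)

weight : ∀ {v n} → (Fin v → ℕ) → (Fin v → Fin n) → ℕ
weight {v} wt c = sum (map (λ i → wt i ℕ.* suc (toℕ (c i))) (allFin v))

chiPoly : ∀ {v} → SimpleGraph v → (Fin v → ℕ) → ℕ → PolyQ
chiPoly {v} G wt n =
  foldr _+P_ []
    (map (λ c → if isProper G c then qPow (weight wt c) else []) (colorings v n))

chiF : ∀ {v} → SimpleGraph v → (Fin v → ℕ) → ℕ → RatFun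
chiF G wt n = fromPolyQ (chiPoly G wt n)

{-# OPTIONS --safe #-}
module Submission where

-- Generalise from the edges of G to an arbitrary list L of constraints c i ≠ c j, and let
-- χ L n be the weighted count of colorings satisfying L. An edge between the first vertex
-- and another one is removed by deletion–contraction, χ (e ∷ L) = χ L − χ (L / e), where the
-- merged vertex carries the sum of the two weights; this lowers the number of vertices.
-- Once no constraint involves the first vertex, the sum factors into χ of the remaining
-- vertices times Σ_{a=1}^{n} q^{λa} = (q^λ − q^λ (q^n)^λ) / (1 − q^λ), and as
-- q^n = 1 − (1 − q) [n]_q this is a polynomial in [n]_q whenever λ > 0. By induction χ_G
-- is a polynomial in [n]_q with coefficients in ℚ(q).
-- Uniqueness: the values [n]_q, n ≥ 1, are pairwise distinct, and a polynomial over a ring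
-- without zero divisors that vanishes at infinitely many points has only zero coefficients.

open import Level using (0ℓ; _⊔_)
open import Algebra.Bundles using (CommutativeMonoid; Semiring; CommutativeRing)
open import Data.Bool using (Bool; true; false; not; _∧_; _∨_; if_then_else_)
open import Data.Bool.ListAction using (all; and)
open import Data.Empty using (⊥-elim)
open import Data.Fin using (Fin; zero; suc; toℕ; _≟_)
open import Data.List using (List; []; _∷_; map; foldr; replicate; _++_; length; concatMap; tabulate; allFin)
open import Data.List.Properties using (++-identityʳ; map-∘)
open import Data.List.Relation.Unary.All as All using (All; []; _∷_)
open import Data.Maybe using (Maybe; just; nothing)
open import Data.Nat as ℕ using (ℕ; zero; suc; _<_)
import Data.Nat.Properties as ℕP
open import Data.Product using (Σ; _×_; _,_; proj₁; proj₂; ∃; ∃₂)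
open import Data.Rational as ℚ using (ℚ; 0ℚ; 1ℚ)
import Data.Rational.Properties as ℚP
open import Data.Vec.Functional using () renaming (_∷_ to _∷ᵥ_)
open import Function using (_∘_; id)
open import Function.Bundles using (mk⇔)
open import Function.Definitions using (Injective)
open import Relation.Binary.PropositionalEquality as ≡ using (_≡_; _≢_)
open import Relation.Nullary using (¬_; Dec; yes; no)
open import Relation.Nullary.Decidable using (⌊_⌋; ⌊⌋-map′; isYes≗does; does-⇔; dec-true)
open import Tactic.RingSolver.Core.AlmostCommutativeRing using (AlmostCommutativeRing; fromCommutativeRing)

open import Defs hiding (sym)

module Polynomial {c ℓ} (R : CommutativeRing c ℓ) where

  open CommutativeRing R hiding (zero)
  open import Algebra.Properties.Ring ring using (-0#≈0#; -‿distribʳ-*)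
  open import Algebra.Properties.AbelianGroup +-abelianGroup using (⁻¹-∙-comm; xyx⁻¹≈y)
  open import Algebra.Properties.Group +-group using (x∙y⁻¹≈ε⇒x≈y; x≈y⇒x∙y⁻¹≈ε)
  open import Algebra.Properties.Semiring.Exp semiring using (_^_)
  open import Relation.Binary.Reasoning.Setoid setoid
  open import Tactic.RingSolver.NonReflective (fromCommutativeRing R (λ _ → nothing))
    using (solve; _⊜_; _⊕_; _⊗_; ⊝_)

  Poly : Set c
  Poly = List Carrier

  eval : Poly → Carrier → Carrier
  eval []      x = 0#
  eval (a ∷ p) x = a + x * eval p x

  coeff : Poly → ℕ → Carrier
  coeff []      _       = 0#
  coeff (a ∷ p) zero    = a
  coeff (a ∷ p) (suc i) = coeff p i

  infixl 6 _+ₚ_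
  infixl 7 _*ₚ_
  infixr 8 _^ₚ_

  _+ₚ_ : Poly → Poly → Poly
  []      +ₚ r       = r
  (a ∷ p) +ₚ []      = a ∷ p
  (a ∷ p) +ₚ (b ∷ r) = (a + b) ∷ (p +ₚ r)

  -ₚ_ : Poly → Poly
  -ₚ_ = map (λ a → - a)

  _*ₚ_ : Poly → Poly → Poly
  []      *ₚ r = []
  (a ∷ p) *ₚ r = map (a *_) r +ₚ (0# ∷ p *ₚ r)

  _^ₚ_ : Poly → ℕ → Poly
  p ^ₚ zero  = 1# ∷ []
  p ^ₚ suc k = p *ₚ p ^ₚ k

  eval-cong : ∀ p {x y} → x ≈ y → eval p x ≈ eval p y
  eval-cong []      x≈y = refl
  eval-cong (a ∷ p) x≈y = +-congˡ (*-cong x≈y (eval-cong p x≈y))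

  eval-const : ∀ a x → eval (a ∷ []) x ≈ a
  eval-const a x = trans (+-congˡ (zeroʳ x)) (+-identityʳ a)

  eval-+ₚ : ∀ p r x → eval (p +ₚ r) x ≈ eval p x + eval r x
  eval-+ₚ []      r       x = sym (+-identityˡ _)
  eval-+ₚ (a ∷ p) []      x = sym (+-identityʳ _)
  eval-+ₚ (a ∷ p) (b ∷ r) x = begin
    (a + b) + x * eval (p +ₚ r) x
      ≈⟨ +-congˡ (*-congˡ (eval-+ₚ p r x)) ⟩
    (a + b) + x * (eval p x + eval r x)
      ≈⟨ solve 5 (λ a b x u v → ((a ⊕ b) ⊕ (x ⊗ (u ⊕ v))) ⊜ ((a ⊕ (x ⊗ u)) ⊕ (b ⊕ (x ⊗ v))))
               refl a b x (eval p x) (eval r x) ⟩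
    (a + x * eval p x) + (b + x * eval r x)
      ∎

  eval-negₚ : ∀ p x → eval (-ₚ p) x ≈ - eval p x
  eval-negₚ []      x = sym -0#≈0#
  eval-negₚ (a ∷ p) x = begin
    - a + x * eval (-ₚ p) x     ≈⟨ +-congˡ (*-congˡ (eval-negₚ p x)) ⟩
    - a + x * - eval p x        ≈⟨ +-congˡ (-‿distribʳ-* x (eval p x)) ⟨
    - a + - (x * eval p x)      ≈⟨ ⁻¹-∙-comm a (x * eval p x) ⟩
    - (a + x * eval p x)        ∎

  eval-scale : ∀ k p x → eval (map (k *_) p) x ≈ k * eval p x
  eval-scale k []      x = sym (zeroʳ k)
  eval-scale k (a ∷ p) x = begin
    k * a + x * eval (map (k *_) p) x
      ≈⟨ +-congˡ (*-congˡ (eval-scale k p x)) ⟩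
    k * a + x * (k * eval p x)
      ≈⟨ solve 4 (λ k a x u → ((k ⊗ a) ⊕ (x ⊗ (k ⊗ u))) ⊜ (k ⊗ (a ⊕ (x ⊗ u)))) refl k a x (eval p x) ⟩
    k * (a + x * eval p x)
      ∎

  eval-*ₚ : ∀ p r x → eval (p *ₚ r) x ≈ eval p x * eval r x
  eval-*ₚ []      r x = sym (zeroˡ _)
  eval-*ₚ (a ∷ p) r x = begin
    eval (map (a *_) r +ₚ (0# ∷ p *ₚ r)) x
      ≈⟨ eval-+ₚ (map (a *_) r) (0# ∷ p *ₚ r) x ⟩
    eval (map (a *_) r) x + (0# + x * eval (p *ₚ r) x)
      ≈⟨ +-cong (eval-scale a r x) (+-identityˡ _) ⟩
    a * eval r x + x * eval (p *ₚ r) x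
      ≈⟨ +-congˡ (*-congˡ (eval-*ₚ p r x)) ⟩
    a * eval r x + x * (eval p x * eval r x)
      ≈⟨ solve 4 (λ a v x u → ((a ⊗ v) ⊕ (x ⊗ (u ⊗ v))) ⊜ ((a ⊕ (x ⊗ u)) ⊗ v)) refl a (eval r x) x (eval p x) ⟩
    (a + x * eval p x) * eval r x
      ∎

  eval-^ₚ : ∀ p k x → eval (p ^ₚ k) x ≈ eval p x ^ k
  eval-^ₚ p zero    x = eval-const 1# x
  eval-^ₚ p (suc k) x = trans (eval-*ₚ p (p ^ₚ k) x) (*-congˡ (eval-^ₚ p k x))

  coeff-+ₚ : ∀ p r i → coeff (p +ₚ r) i ≈ coeff p i + coeff r i
  coeff-+ₚ []      r       i       = sym (+-identityˡ _)
  coeff-+ₚ (a ∷ p) []      zero    = sym (+-identityʳ _)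
  coeff-+ₚ (a ∷ p) []      (suc i) = sym (+-identityʳ _)
  coeff-+ₚ (a ∷ p) (b ∷ r) zero    = refl
  coeff-+ₚ (a ∷ p) (b ∷ r) (suc i) = coeff-+ₚ p r i

  coeff-negₚ : ∀ p i → coeff (-ₚ p) i ≈ - coeff p i
  coeff-negₚ []      i       = sym -0#≈0#
  coeff-negₚ (a ∷ p) zero    = refl
  coeff-negₚ (a ∷ p) (suc i) = coeff-negₚ p i

  -- The quotient of x·p(x) − x₀·p(x₀) by x − x₀.
  divide : Carrier → Poly → Poly
  divide x₀ []      = []
  divide x₀ (b ∷ p) = eval (b ∷ p) x₀ ∷ divide x₀ p

  length-divide : ∀ x₀ p → length (divide x₀ p) ≡ length p
  length-divide x₀ []      = ≡.refl
  length-divide x₀ (b ∷ p) = ≡.cong suc (length-divide x₀ p)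

  -- Stated at x₀ + d rather than at x with x - x₀: the ring solver over an abstract ring
  -- cannot cancel a term against its negative.
  divide-spec : ∀ x₀ d p → (x₀ + d) * eval p (x₀ + d) ≈ x₀ * eval p x₀ + d * eval (divide x₀ p) (x₀ + d)
  divide-spec x₀ d []      = trans (zeroʳ _) (sym (trans (+-cong (zeroʳ x₀) (zeroʳ d)) (+-identityʳ 0#)))
  divide-spec x₀ d (b ∷ p) = begin
    x * (b + x * eval p x)
      ≈⟨ *-congˡ (+-congˡ (divide-spec x₀ d p)) ⟩
    x * (b + (x₀ * eval p x₀ + d * eval (divide x₀ p) x))
      ≈⟨ solve 5 (λ x₀ d b u v → ((x₀ ⊕ d) ⊗ (b ⊕ ((x₀ ⊗ u) ⊕ (d ⊗ v))))
                              ⊜ ((x₀ ⊗ (b ⊕ (x₀ ⊗ u))) ⊕ (d ⊗ ((b ⊕ (x₀ ⊗ u)) ⊕ ((x₀ ⊕ d) ⊗ v)))))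
               refl x₀ d b (eval p x₀) (eval (divide x₀ p) x) ⟩
    x₀ * (b + x₀ * eval p x₀) + d * (eval (b ∷ p) x₀ + x * eval (divide x₀ p) x)
      ∎
    where x : Carrier
          x = x₀ + d

  module _ (no-zero-divisors : ∀ a b → ¬ (a ≈ 0#) → a * b ≈ 0# → b ≈ 0#) where

    divide-≈0⇒≈0 : ∀ a p x₀ → (∀ i → coeff (divide x₀ p) i ≈ 0#) → a + x₀ * eval p x₀ ≈ 0# →
                   ∀ i → coeff (a ∷ p) i ≈ 0#
    divide-≈0⇒≈0 a []      x₀ _   a≈0 zero    = trans (sym (trans (+-congˡ (zeroʳ x₀)) (+-identityʳ a))) a≈0
    divide-≈0⇒≈0 a []      x₀ _   _   (suc i) = refl
    divide-≈0⇒≈0 a (b ∷ p) x₀ q≈0 a≈0 zero    =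
      trans (sym (trans (+-congˡ (trans (*-congˡ (q≈0 zero)) (zeroʳ x₀))) (+-identityʳ a))) a≈0
    divide-≈0⇒≈0 a (b ∷ p) x₀ q≈0 _   (suc i) = divide-≈0⇒≈0 b p x₀ (q≈0 ∘ suc) (q≈0 zero) i

    -- Induction on the length: the quotient by x - Y 0 has the length of the tail and
    -- vanishes at all other points.
    vanishing⇒coeff≈0 : ∀ n p → length p ≡ n → (Y : ℕ → Carrier) → Injective _≡_ _≈_ Y →
                        (∀ k → eval p (Y k) ≈ 0#) → ∀ i → coeff p i ≈ 0#
    vanishing⇒coeff≈0 _       []      _     Y Y-inj p≈0 i = refl
    vanishing⇒coeff≈0 (suc n) (a ∷ p) |p|≡n Y Y-inj p≈0 =
      divide-≈0⇒≈0 a p x₀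
        (vanishing⇒coeff≈0 n (divide x₀ p) |q|≡n (Y ∘ suc) (ℕP.suc-injective ∘ Y-inj) q≈0) (p≈0 0)
      where
      x₀ : Carrier
      x₀ = Y 0
      |q|≡n : length (divide x₀ p) ≡ n
      |q|≡n = ≡.trans (length-divide x₀ p) (ℕP.suc-injective |p|≡n)
      q≈0 : ∀ k → eval (divide x₀ p) (Y (suc k)) ≈ 0#
      q≈0 k = no-zero-divisors d (eval (divide x₀ p) y) d≉0 (begin
        d * eval (divide x₀ p) y                          ≈⟨ +-identityˡ _ ⟨
        0# + d * eval (divide x₀ p) y                     ≈⟨ +-congʳ (p≈0 0) ⟨
        (a + x₀ * eval p x₀) + d * eval (divide x₀ p) y   ≈⟨ +-assoc a _ _ ⟩
        a + (x₀ * eval p x₀ + d * eval (divide x₀ p) y)   ≈⟨ +-congˡ (+-congˡ (*-congˡ (eval-cong (divide x₀ p) x₀+d≈y))) ⟨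
        a + (x₀ * eval p x₀ + d * eval (divide x₀ p) (x₀ + d)) ≈⟨ +-congˡ (divide-spec x₀ d p) ⟨
        a + (x₀ + d) * eval p (x₀ + d)                    ≈⟨ +-congˡ (*-cong x₀+d≈y (eval-cong p x₀+d≈y)) ⟩
        a + y * eval p y                                  ≈⟨ p≈0 (suc k) ⟩
        0#                                                ∎)
        where
        y d : Carrier
        y = Y (suc k)
        d = y - x₀
        x₀+d≈y : x₀ + d ≈ y
        x₀+d≈y = trans (sym (+-assoc x₀ y (- x₀))) (xyx⁻¹≈y x₀ y)
        d≉0 : ¬ (d ≈ 0#)
        d≉0 d≈0 = ℕP.1+n≢0 (Y-inj (x∙y⁻¹≈ε⇒x≈y y x₀ d≈0))

    agreeing⇒coeff≈ : (Y : ℕ → Carrier) → Injective _≡_ _≈_ Y → ∀ p r →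
                      (∀ k → eval p (Y k) ≈ eval r (Y k)) → ∀ i → coeff p i ≈ coeff r i
    agreeing⇒coeff≈ Y Y-inj p r p≈r i = x∙y⁻¹≈ε⇒x≈y _ _ (begin
      coeff p i - coeff r i        ≈⟨ +-congˡ (coeff-negₚ r i) ⟨
      coeff p i + coeff (-ₚ r) i   ≈⟨ coeff-+ₚ p (-ₚ r) i ⟨
      coeff (p +ₚ -ₚ r) i          ≈⟨ vanishing⇒coeff≈0 _ (p +ₚ -ₚ r) ≡.refl Y Y-inj p-r≈0 i ⟩
      0#                           ∎)
      where
      p-r≈0 : ∀ k → eval (p +ₚ -ₚ r) (Y k) ≈ 0#
      p-r≈0 k = trans (eval-+ₚ p (-ₚ r) (Y k)) (trans (+-congˡ (eval-negₚ r (Y k))) (x≈y⇒x∙y⁻¹≈ε (p≈r k)))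

module Sums {c ℓ} (S : Semiring c ℓ) where

  open Semiring S hiding (zero)
  open import Algebra.Properties.Semiring.Sum S public
    using (sum; sum-syntax; sum-cong-≋; sum-replicate-zero; ∑-distrib-+; *-distribˡ-sum)
  open import Relation.Binary.Reasoning.Setoid setoid

  𝟙 : Bool → Carrier
  𝟙 true  = 1#
  𝟙 false = 0#

  sum-δ : ∀ {n} (j : Fin n) (f : Fin n → Carrier) → ∑[ i < n ] (𝟙 ⌊ i ≟ j ⌋ * f i) ≈ f j
  sum-δ {suc n} zero f = begin
    1# * f zero + ∑[ i < n ] (0# * f (suc i))   ≈⟨ +-cong (*-identityˡ _) (sum-cong-≋ (λ i → zeroˡ (f (suc i)))) ⟩
    f zero + ∑[ i < n ] 0#                      ≈⟨ +-congˡ (sum-replicate-zero n) ⟩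
    f zero + 0#                                 ≈⟨ +-identityʳ _ ⟩
    f zero                                      ∎
  sum-δ {suc n} (suc j) f = begin
    0# * f zero + ∑[ i < n ] (𝟙 ⌊ suc i ≟ suc j ⌋ * f (suc i))
      ≈⟨ +-cong (zeroˡ (f zero)) (sum-cong-≋ (λ i → *-congʳ (reflexive (≡.cong 𝟙 (⌊⌋-map′ _ _ (i ≟ j)))))) ⟩
    0# + ∑[ i < n ] (𝟙 ⌊ i ≟ j ⌋ * f (suc i))
      ≈⟨ +-identityˡ _ ⟩
    ∑[ i < n ] (𝟙 ⌊ i ≟ j ⌋ * f (suc i))
      ≈⟨ sum-δ j (λ i → f (suc i)) ⟩
    f (suc j)
      ∎

  ∑ₗ : ∀ {A : Set} → List A → (A → Carrier) → Carrier
  ∑ₗ []       f = 0#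
  ∑ₗ (x ∷ xs) f = f x + ∑ₗ xs f

  ∑ₗ-cong : ∀ {A : Set} (xs : List A) {f g : A → Carrier} → (∀ x → f x ≈ g x) → ∑ₗ xs f ≈ ∑ₗ xs g
  ∑ₗ-cong []       f≈g = refl
  ∑ₗ-cong (x ∷ xs) f≈g = +-cong (f≈g x) (∑ₗ-cong xs f≈g)

  ∑ₗ-distrib-+ : ∀ {A : Set} (xs : List A) (f g : A → Carrier) → ∑ₗ xs (λ x → f x + g x) ≈ ∑ₗ xs f + ∑ₗ xs g
  ∑ₗ-distrib-+ []       f g = sym (+-identityʳ 0#)
  ∑ₗ-distrib-+ (x ∷ xs) f g = begin
    (f x + g x) + ∑ₗ xs (λ x → f x + g x)  ≈⟨ +-congˡ (∑ₗ-distrib-+ xs f g) ⟩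
    (f x + g x) + (∑ₗ xs f + ∑ₗ xs g)      ≈⟨ +-assoc (f x) (g x) _ ⟩
    f x + (g x + (∑ₗ xs f + ∑ₗ xs g))      ≈⟨ +-congˡ (x∙yz≈y∙xz (g x) (∑ₗ xs f) (∑ₗ xs g)) ⟩
    f x + (∑ₗ xs f + (g x + ∑ₗ xs g))      ≈⟨ +-assoc (f x) _ _ ⟨
    (f x + ∑ₗ xs f) + (g x + ∑ₗ xs g)      ∎
    where open import Algebra.Properties.CommutativeSemigroup +-commutativeSemigroup using (x∙yz≈y∙xz)

  *-distribʳ-∑ₗ : ∀ {A : Set} (xs : List A) (f : A → Carrier) k → ∑ₗ xs f * k ≈ ∑ₗ xs (λ x → f x * k)
  *-distribʳ-∑ₗ []       f k = zeroˡ k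
  *-distribʳ-∑ₗ (x ∷ xs) f k = trans (distribʳ k (f x) (∑ₗ xs f)) (+-congˡ (*-distribʳ-∑ₗ xs f k))

  ∑ₗ-zero : ∀ {A : Set} (xs : List A) → ∑ₗ xs (λ _ → 0#) ≈ 0#
  ∑ₗ-zero []       = refl
  ∑ₗ-zero (x ∷ xs) = trans (+-identityˡ _) (∑ₗ-zero xs)

  ∑ₗ-++ : ∀ {A : Set} (xs ys : List A) f → ∑ₗ (xs ++ ys) f ≈ ∑ₗ xs f + ∑ₗ ys f
  ∑ₗ-++ []       ys f = sym (+-identityˡ _)
  ∑ₗ-++ (x ∷ xs) ys f = trans (+-congˡ (∑ₗ-++ xs ys f)) (sym (+-assoc _ _ _))

  ∑ₗ-concatMap : ∀ {A B : Set} (g : A → List B) (xs : List A) f →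
                 ∑ₗ (concatMap g xs) f ≈ ∑ₗ xs (λ x → ∑ₗ (g x) f)
  ∑ₗ-concatMap g []       f = refl
  ∑ₗ-concatMap g (x ∷ xs) f = trans (∑ₗ-++ (g x) (concatMap g xs) f) (+-congˡ (∑ₗ-concatMap g xs f))

  ∑ₗ-map : ∀ {A B : Set} (h : A → B) (xs : List A) f → ∑ₗ (map h xs) f ≡ ∑ₗ xs (f ∘ h)
  ∑ₗ-map h []       f = ≡.refl
  ∑ₗ-map h (x ∷ xs) f = ≡.cong (f (h x) +_) (∑ₗ-map h xs f)

  ∑ₗ-tabulate : ∀ {A : Set} n (g : Fin n → A) f → ∑ₗ (tabulate g) f ≡ sum (f ∘ g)
  ∑ₗ-tabulate zero    g f = ≡.refl
  ∑ₗ-tabulate (suc n) g f = ≡.cong (f (g zero) +_) (∑ₗ-tabulate n (g ∘ suc) f)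

  ∑ₗ-allFin : ∀ n (f : Fin n → Carrier) → ∑ₗ (allFin n) f ≡ sum f
  ∑ₗ-allFin n = ∑ₗ-tabulate n id

  𝟙-partition : ∀ e o y → 𝟙 (not e ∧ o) * y + 𝟙 e * (𝟙 o * y) ≈ 𝟙 o * y
  𝟙-partition true  o y = trans (+-cong (zeroˡ y) (*-identityˡ _)) (+-identityˡ _)
  𝟙-partition false o y = trans (+-congˡ (zeroˡ _)) (+-identityʳ _)

module Weights where

  open Sums ℕP.+-*-semiring
  import Data.Nat.ListAction as ℕList
  open ≡
  open ≡-Reasoning

  sum-map≡∑ₗ : ∀ {A : Set} (xs : List A) (f : A → ℕ) → ℕList.sum (map f xs) ≡ ∑ₗ xs f
  sum-map≡∑ₗ []       f = refl
  sum-map≡∑ₗ (x ∷ xs) f = cong (f x ℕ.+_) (sum-map≡∑ₗ xs f)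

  weight≡∑ : ∀ {v n} (wt : Fin v → ℕ) (c : Fin v → Fin n) → weight wt c ≡ ∑[ i < v ] (wt i ℕ.* suc (toℕ (c i)))
  weight≡∑ {v} wt c = trans (sum-map≡∑ₗ (allFin v) _) (∑ₗ-allFin v _)

  weight-∷ : ∀ {v n} (wt : Fin (suc v) → ℕ) (a : Fin n) (c : Fin v → Fin n) →
             weight wt (a ∷ᵥ c) ≡ wt zero ℕ.* suc (toℕ a) ℕ.+ weight (wt ∘ suc) c
  weight-∷ wt a c = trans (weight≡∑ wt (a ∷ᵥ c)) (cong (wt zero ℕ.* suc (toℕ a) ℕ.+_) (sym (weight≡∑ (wt ∘ suc) c)))

  contractWeight : ∀ {v} → (Fin (suc v) → ℕ) → Fin v → Fin v → ℕ
  contractWeight wt j i = wt (suc i) ℕ.+ 𝟙 ⌊ i ≟ j ⌋ ℕ.* wt zero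

  contractWeight-pos : ∀ {v} (wt : Fin (suc v) → ℕ) j → (∀ i → 0 < wt i) → ∀ i → 0 < contractWeight wt j i
  contractWeight-pos wt j wt>0 i = ℕP.<-≤-trans (wt>0 (suc i)) (ℕP.m≤m+n _ _)

  weight-contract : ∀ {v n} (wt : Fin (suc v) → ℕ) (j : Fin v) (c : Fin v → Fin n) →
                    weight wt (c j ∷ᵥ c) ≡ weight (contractWeight wt j) c
  weight-contract {v} wt j c = begin
    weight wt (c j ∷ᵥ c)
      ≡⟨ weight-∷ wt (c j) c ⟩
    wt zero ℕ.* s j ℕ.+ weight (wt ∘ suc) c
      ≡⟨ cong₂ ℕ._+_ (sym (sum-δ j (λ i → wt zero ℕ.* s i))) (weight≡∑ (wt ∘ suc) c) ⟩
    ∑[ i < v ] (𝟙 ⌊ i ≟ j ⌋ ℕ.* (wt zero ℕ.* s i)) ℕ.+ ∑[ i < v ] (wt (suc i) ℕ.* s i)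
      ≡⟨ sym (∑-distrib-+ (λ i → 𝟙 ⌊ i ≟ j ⌋ ℕ.* (wt zero ℕ.* s i)) (λ i → wt (suc i) ℕ.* s i)) ⟩
    ∑[ i < v ] (𝟙 ⌊ i ≟ j ⌋ ℕ.* (wt zero ℕ.* s i) ℕ.+ wt (suc i) ℕ.* s i)
      ≡⟨ sum-cong-≋ (λ i → solve 4 (λ d w₀ s w → d :* (w₀ :* s) :+ w :* s := (w :+ d :* w₀) :* s) refl
                                    (𝟙 ⌊ i ≟ j ⌋) (wt zero) (s i) (wt (suc i))) ⟩
    ∑[ i < v ] (contractWeight wt j i ℕ.* s i)
      ≡⟨ sym (weight≡∑ (contractWeight wt j) c) ⟩
    weight (contractWeight wt j) c
      ∎
    where
    open import Data.Nat.Solver using (module +-*-Solver)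
    open +-*-Solver using (solve; _:=_; _:+_; _:*_)
    s : Fin v → ℕ
    s i = suc (toℕ (c i))

module Constraints where

  open import Data.Bool.Properties using (∧-assoc; ∧-commutativeMonoid)
  open import Algebra.Properties.CommutativeSemigroup
    (CommutativeMonoid.commutativeSemigroup ∧-commutativeMonoid) using (x∙yz≈y∙xz)

  -- (b , i , j) demands c i ≠ c j when b is true and nothing otherwise, matching how
  -- isProper reads the adjacency matrix.
  Constraint : ℕ → Set
  Constraint v = Bool × Fin v × Fin v

  infix 7 _⊨_ _⊨*_

  _⊨_ : ∀ {v n} → (Fin v → Fin n) → Constraint v → Bool
  c ⊨ (b , i , j) = not b ∨ not ⌊ c i ≟ c j ⌋

  _⊨*_ : ∀ {v n} → (Fin v → Fin n) → List (Constraint v) → Bool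
  c ⊨* L = all (c ⊨_) L

  ⌊≟⌋-sym : ∀ {n} (a b : Fin n) → ⌊ a ≟ b ⌋ ≡ ⌊ b ≟ a ⌋
  ⌊≟⌋-sym a b = ≡.trans (isYes≗does (a ≟ b))
    (≡.trans (does-⇔ (mk⇔ ≡.sym ≡.sym) (a ≟ b) (b ≟ a)) (≡.sym (isYes≗does (b ≟ a))))

  ⊨*-++ : ∀ {v n} (c : Fin v → Fin n) K L → c ⊨* (K ++ L) ≡ (c ⊨* K ∧ c ⊨* L)
  ⊨*-++ c []      L = ≡.refl
  ⊨*-++ c (x ∷ K) L = ≡.trans (≡.cong (c ⊨ x ∧_) (⊨*-++ c K L)) (≡.sym (∧-assoc (c ⊨ x) _ _))

  ⊨*-∷-++ : ∀ {v n} (c : Fin v → Fin n) x K L → c ⊨* (x ∷ K ++ L) ≡ c ⊨* (K ++ x ∷ L)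
  ⊨*-∷-++ c x K L = ≡.trans (≡.cong (c ⊨ x ∧_) (⊨*-++ c K L))
    (≡.trans (x∙yz≈y∙xz (c ⊨ x) (c ⊨* K) (c ⊨* L)) (≡.sym (⊨*-++ c K (x ∷ L))))

  ⊨*-map : ∀ {u v n m} (c : Fin u → Fin n) (c′ : Fin v → Fin m) (f : Constraint v → Constraint u) →
           (∀ x → c ⊨ f x ≡ c′ ⊨ x) → ∀ K → c ⊨* map f K ≡ c′ ⊨* K
  ⊨*-map c c′ f f-sound []      = ≡.refl
  ⊨*-map c c′ f f-sound (x ∷ K) = ≡.cong₂ _∧_ (f-sound x) (⊨*-map c c′ f f-sound K)

  ↑ : ∀ {v} → Constraint v → Constraint (suc v)
  ↑ (b , i , j) = b , suc i , suc j

  merge : ∀ {v} → Fin v → Fin (suc v) → Fin v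
  merge j zero    = j
  merge j (suc i) = i

  contract : ∀ {v} → Fin v → List (Constraint (suc v)) → List (Constraint v)
  contract j = map (λ (b , i , k) → b , merge j i , merge j k)

  ⊨*-contract : ∀ {v n} (c : Fin v → Fin n) j K → c ⊨* contract j K ≡ (c j ∷ᵥ c) ⊨* K
  ⊨*-contract c j = ⊨*-map c (c j ∷ᵥ c) _ ⊨-merge
    where
    ⊨-merge : ∀ x → c ⊨ (proj₁ x , merge j (proj₁ (proj₂ x)) , merge j (proj₂ (proj₂ x))) ≡ (c j ∷ᵥ c) ⊨ x
    ⊨-merge (b , zero  , zero ) = ≡.refl
    ⊨-merge (b , zero  , suc k) = ≡.refl
    ⊨-merge (b , suc i , zero ) = ≡.refl
    ⊨-merge (b , suc i , suc k) = ≡.refl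

  adjacencyRow : ∀ {v} → SimpleGraph v → Fin v → List (Constraint v)
  adjacencyRow {v} G i = map (λ j → adj G i j , i , j) (allFin v)

  edges : ∀ {v} → SimpleGraph v → List (Constraint v)
  edges {v} G = concatMap (adjacencyRow G) (allFin v)

  isProper≡⊨*edges : ∀ {v n} (G : SimpleGraph v) (c : Fin v → Fin n) → isProper G c ≡ c ⊨* edges G
  isProper≡⊨*edges {v} G c = ≡.sym (⊨*-concatMap (allFin v))
    where
    ⊨*-concatMap : ∀ is → c ⊨* concatMap (adjacencyRow G) is
                          ≡ all (λ i → all (λ j → c ⊨ (adj G i j , i , j)) (allFin v)) is
    ⊨*-concatMap []       = ≡.refl
    ⊨*-concatMap (i ∷ is) = ≡.trans (⊨*-++ c (adjacencyRow G i) _)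
      (≡.cong₂ _∧_ (≡.cong and (≡.sym (map-∘ {g = c ⊨_} (allFin v)))) (⊨*-concatMap is))

module ColoringSums {r ℓ} (R : CommutativeRing r ℓ) (q : CommutativeRing.Carrier R) where

  open CommutativeRing R hiding (zero)
  open Sums semiring
  open Weights using (weight-∷; contractWeight; weight-contract)
  open import Algebra.Properties.Semiring.Exp semiring using (_^_; ^-homo-*)
  open import Relation.Binary.Reasoning.Setoid setoid

  open Constraints

  χ : ∀ {v} → List (Constraint v) → (Fin v → ℕ) → ℕ → Carrier
  χ {v} L wt n = ∑ₗ (colorings v n) (λ c → 𝟙 (c ⊨* L) * q ^ weight wt c)

  χ-cong : ∀ {v} (K L : List (Constraint v)) → (∀ {n} (c : Fin v → Fin n) → c ⊨* K ≡ c ⊨* L) →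
           ∀ wt n → χ K wt n ≈ χ L wt n
  χ-cong {v} K L K≡L wt n = ∑ₗ-cong (colorings v n) (λ c → *-congʳ (reflexive (≡.cong 𝟙 (K≡L c))))

  ∑ₗ-colorings-suc : ∀ v n f → ∑ₗ (colorings (suc v) n) f ≈ ∑ₗ (colorings v n) (λ c → ∑[ a < n ] f (a ∷ᵥ c))
  ∑ₗ-colorings-suc v n f = trans (∑ₗ-concatMap _ (colorings v n) f) (∑ₗ-cong (colorings v n) (λ c →
    reflexive (≡.trans (∑ₗ-map (_∷ᵥ c) (allFin n) f) (∑ₗ-allFin n (λ a → f (a ∷ᵥ c))))))

  χ-swap : ∀ {v} b (i j : Fin v) K → ∀ wt n → χ ((b , i , j) ∷ K) wt n ≈ χ ((b , j , i) ∷ K) wt n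
  χ-swap b i j K = χ-cong ((b , i , j) ∷ K) ((b , j , i) ∷ K)
    (λ c → ≡.cong (λ e → (not b ∨ not e) ∧ c ⊨* K) (⌊≟⌋-sym (c i) (c j)))

  χ-loop : ∀ {v} (i : Fin v) K → ∀ wt n → χ ((true , i , i) ∷ K) wt n ≈ 0#
  χ-loop {v} i K wt n = trans (∑ₗ-cong (colorings v n) (λ c → trans (*-congʳ (𝟙-unsatisfied c)) (zeroˡ _)))
                              (∑ₗ-zero (colorings v n))
    where
    𝟙-unsatisfied : ∀ {n} (c : Fin v → Fin n) → 𝟙 (c ⊨* ((true , i , i) ∷ K)) ≈ 0#
    𝟙-unsatisfied c = reflexive (≡.cong (λ e → 𝟙 (not e ∧ c ⊨* K))
      (≡.trans (isYes≗does (c i ≟ c i)) (dec-true (c i ≟ c i) ≡.refl)))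

  χ-↑ : ∀ {v} (M : List (Constraint v)) (wt : Fin (suc v) → ℕ) n →
        χ (map ↑ M) wt n ≈ χ M (wt ∘ suc) n * ∑[ a < n ] (q ^ (wt zero ℕ.* suc (toℕ a)))
  χ-↑ {v} M wt n = begin
    χ (map ↑ M) wt n
      ≈⟨ ∑ₗ-colorings-suc v n _ ⟩
    ∑ₗ (colorings v n) (λ c → ∑[ a < n ] (𝟙 ((a ∷ᵥ c) ⊨* map ↑ M) * q ^ weight wt (a ∷ᵥ c)))
      ≈⟨ ∑ₗ-cong (colorings v n) (λ c → sum-cong-≋ (λ a → term c a)) ⟩
    ∑ₗ (colorings v n) (λ c → ∑[ a < n ] (F c * G a))
      ≈⟨ ∑ₗ-cong (colorings v n) (λ c → sym (*-distribˡ-sum (F c) G)) ⟩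
    ∑ₗ (colorings v n) (λ c → F c * ∑[ a < n ] G a)
      ≈⟨ *-distribʳ-∑ₗ (colorings v n) F _ ⟨
    χ M (wt ∘ suc) n * ∑[ a < n ] G a
      ∎
    where
    open import Algebra.Properties.CommutativeSemigroup *-commutativeSemigroup using (x∙yz≈xz∙y)
    F : (Fin v → Fin n) → Carrier
    F c = 𝟙 (c ⊨* M) * q ^ weight (wt ∘ suc) c
    G : Fin n → Carrier
    G a = q ^ (wt zero ℕ.* suc (toℕ a))
    term : ∀ c a → 𝟙 ((a ∷ᵥ c) ⊨* map ↑ M) * q ^ weight wt (a ∷ᵥ c) ≈ F c * G a
    term c a = begin
      𝟙 ((a ∷ᵥ c) ⊨* map ↑ M) * q ^ weight wt (a ∷ᵥ c)
        ≈⟨ *-cong (reflexive (≡.cong 𝟙 (⊨*-map (a ∷ᵥ c) c ↑ (λ _ → ≡.refl) M)))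
                  (reflexive (≡.cong (q ^_) (weight-∷ wt a c))) ⟩
      𝟙 (c ⊨* M) * q ^ (wt zero ℕ.* suc (toℕ a) ℕ.+ weight (wt ∘ suc) c)
        ≈⟨ *-congˡ (^-homo-* q (wt zero ℕ.* suc (toℕ a)) (weight (wt ∘ suc) c)) ⟩
      𝟙 (c ⊨* M) * (G a * q ^ weight (wt ∘ suc) c)
        ≈⟨ x∙yz≈xz∙y _ _ _ ⟩
      F c * G a
        ∎

  χ-contract : ∀ {v} (j : Fin v) K (wt : Fin (suc v) → ℕ) n →
               ∑ₗ (colorings (suc v) n) (λ c → 𝟙 ⌊ c zero ≟ c (suc j) ⌋ * (𝟙 (c ⊨* K) * q ^ weight wt c))
               ≈ χ (contract j K) (contractWeight wt j) n
  χ-contract {v} j K wt n = begin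
    ∑ₗ (colorings (suc v) n) (λ c → 𝟙 ⌊ c zero ≟ c (suc j) ⌋ * F c)
      ≈⟨ ∑ₗ-colorings-suc v n _ ⟩
    ∑ₗ (colorings v n) (λ c → ∑[ a < n ] (𝟙 ⌊ a ≟ c j ⌋ * F (a ∷ᵥ c)))
      ≈⟨ ∑ₗ-cong (colorings v n) (λ c → sum-δ (c j) (λ a → F (a ∷ᵥ c))) ⟩
    ∑ₗ (colorings v n) (λ c → F (c j ∷ᵥ c))
      ≈⟨ ∑ₗ-cong (colorings v n) (λ c → reflexive (≡.cong₂ (λ b k → 𝟙 b * q ^ k)
                                     (≡.sym (⊨*-contract c j K)) (weight-contract wt j c))) ⟩
    χ (contract j K) (contractWeight wt j) n
      ∎
    where
    F : (Fin (suc v) → Fin n) → Carrier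
    F c = 𝟙 (c ⊨* K) * q ^ weight wt c

  χ-delete-contract : ∀ {v} (j : Fin v) K (wt : Fin (suc v) → ℕ) n →
                      χ ((true , zero , suc j) ∷ K) wt n + χ (contract j K) (contractWeight wt j) n ≈ χ K wt n
  χ-delete-contract {v} j K wt n = begin
    χ ((true , zero , suc j) ∷ K) wt n + χ (contract j K) (contractWeight wt j) n
      ≈⟨ +-congˡ (χ-contract j K wt n) ⟨
    ∑ₗ cs (λ c → 𝟙 (not (e c) ∧ c ⊨* K) * Y c) + ∑ₗ cs (λ c → 𝟙 (e c) * (𝟙 (c ⊨* K) * Y c))
      ≈⟨ ∑ₗ-distrib-+ cs _ _ ⟨
    ∑ₗ cs (λ c → 𝟙 (not (e c) ∧ c ⊨* K) * Y c + 𝟙 (e c) * (𝟙 (c ⊨* K) * Y c))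
      ≈⟨ ∑ₗ-cong cs (λ c → 𝟙-partition (e c) (c ⊨* K) (Y c)) ⟩
    χ K wt n
      ∎
    where
    cs : List (Fin (suc v) → Fin n)
    cs = colorings (suc v) n
    e : (Fin (suc v) → Fin n) → Bool
    e c = ⌊ c zero ≟ c (suc j) ⌋
    Y : (Fin (suc v) → Fin n) → Carrier
    Y c = q ^ weight wt c

module Interpolation {r ℓ} (R : CommutativeRing r ℓ) where

  open CommutativeRing R hiding (zero)
  open Polynomial R
  open Sums semiring
  open Weights using (contractWeight; contractWeight-pos)
  open import Algebra.Properties.Semiring.Exp semiring using (_^_; ^-assocʳ; ^-congˡ)
  open import Algebra.Properties.Ring ring using (-‿distribʳ-*)
  open import Algebra.Properties.Group +-group using (quasigroup; ⁻¹-involutive)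
  open import Algebra.Properties.Quasigroup quasigroup using (x≈z//y)
  open import Relation.Binary.Reasoning.Setoid setoid
  open import Tactic.RingSolver.NonReflective (fromCommutativeRing R (λ _ → nothing)) using (solve; _⊜_; _⊕_; _⊗_)

  PolynomialIn : (ℕ → Carrier) → (ℕ → Carrier) → Set (r ⊔ ℓ)
  PolynomialIn X f = ∃ λ p → ∀ n → eval p (X n) ≈ f n

  module _ {X : ℕ → Carrier} where

    PolynomialIn-cong : ∀ {f g} → (∀ n → f n ≈ g n) → PolynomialIn X f → PolynomialIn X g
    PolynomialIn-cong f≈g (p , p≈f) = p , λ n → trans (p≈f n) (f≈g n)

    PolynomialIn-const : ∀ a → PolynomialIn X (λ _ → a)
    PolynomialIn-const a = (a ∷ []) , λ n → eval-const a (X n)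

    PolynomialIn-* : ∀ {f g} → PolynomialIn X f → PolynomialIn X g → PolynomialIn X (λ n → f n * g n)
    PolynomialIn-* (p , p≈f) (s , s≈g) = p *ₚ s , λ n → trans (eval-*ₚ p s (X n)) (*-cong (p≈f n) (s≈g n))

    PolynomialIn-difference : ∀ {f g h} → PolynomialIn X g → PolynomialIn X h → (∀ n → f n + g n ≈ h n) →
                              PolynomialIn X f
    PolynomialIn-difference (s , s≈g) (t , t≈h) f+g≈h = t +ₚ -ₚ s , λ n → begin
      eval (t +ₚ -ₚ s) (X n)        ≈⟨ eval-+ₚ t (-ₚ s) (X n) ⟩
      eval t (X n) + eval (-ₚ s) (X n) ≈⟨ +-cong (t≈h n) (trans (eval-negₚ s (X n)) (-‿cong (s≈g n))) ⟩
      _ - _                         ≈⟨ x≈z//y _ _ _ (f+g≈h n) ⟨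
      _                             ∎

  geometric-sum : ∀ ρ g → g * (1# - ρ) ≈ 1# → ∀ n → ∑[ a < n ] (ρ ^ suc (toℕ a)) ≈ g * ρ - g * ρ ^ suc n
  geometric-sum ρ g g[1-ρ]≈1 n = x≈z//y _ _ _ (partial n)
    where
    g≈1+gρ : g ≈ 1# + g * ρ
    g≈1+gρ = trans (x≈z//y g (- (g * ρ)) 1# (begin
      g - g * ρ          ≈⟨ +-cong (*-identityʳ g) (sym (-‿distribʳ-* g ρ)) ⟨
      g * 1# + g * - ρ   ≈⟨ distribˡ g 1# (- ρ) ⟨
      g * (1# - ρ)       ≈⟨ g[1-ρ]≈1 ⟩
      1#                 ∎)) (+-congˡ (⁻¹-involutive (g * ρ)))
    partial : ∀ n → ∑[ a < n ] (ρ ^ suc (toℕ a)) + g * ρ ^ suc n ≈ g * ρ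
    partial zero    = trans (+-identityˡ _) (*-congˡ (*-identityʳ ρ))
    partial (suc n) = begin
      (ρ * 1# + ∑[ a < n ] (ρ ^ suc (suc (toℕ a)))) + g * (ρ * ρ ^ suc n)
        ≈⟨ +-congʳ (+-cong (*-identityʳ ρ) (sym (*-distribˡ-sum {n} ρ (λ a → ρ ^ suc (toℕ a))))) ⟩
      (ρ + ρ * ∑[ a < n ] (ρ ^ suc (toℕ a))) + g * (ρ * ρ ^ suc n)
        ≈⟨ solve 4 (λ ρ s g t → ((ρ ⊕ (ρ ⊗ s)) ⊕ (g ⊗ (ρ ⊗ t))) ⊜ (ρ ⊕ (ρ ⊗ (s ⊕ (g ⊗ t))))) refl ρ _ g _ ⟩
      ρ + ρ * (∑[ a < n ] (ρ ^ suc (toℕ a)) + g * ρ ^ suc n)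
        ≈⟨ +-congˡ (*-congˡ (partial n)) ⟩
      ρ + ρ * (g * ρ)
        ≈⟨ +-congʳ (*-identityʳ ρ) ⟨
      ρ * 1# + ρ * (g * ρ)
        ≈⟨ distribˡ ρ 1# (g * ρ) ⟨
      ρ * (1# + g * ρ)
        ≈⟨ *-congˡ g≈1+gρ ⟨
      ρ * g
        ≈⟨ *-comm ρ g ⟩
      g * ρ
        ∎

  -- q ^ n is the value at X n of the linear polynomial 1 - (1 - q) x; every coloring sum
  -- is assembled from such powers by sums and products.
  module _ (q : Carrier) (X : ℕ → Carrier) (q^n≈ : ∀ n → q ^ n ≈ 1# - (1# - q) * X n)
           (1-q^w-invertible : ∀ w → 0 < w → ∃ λ g → g * (1# - q ^ w) ≈ 1#) where

    open Constraints
    open ColoringSums R q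

    linear : Poly
    linear = 1# ∷ - (1# - q) ∷ []

    eval-linear : ∀ n → eval linear (X n) ≈ q ^ n
    eval-linear n = begin
      1# + X n * (- (1# - q) + X n * 0#) ≈⟨ +-congˡ (*-congˡ (trans (+-congˡ (zeroʳ (X n))) (+-identityʳ _))) ⟩
      1# + X n * - (1# - q)              ≈⟨ +-congˡ (-‿distribʳ-* (X n) (1# - q)) ⟨
      1# - X n * (1# - q)                ≈⟨ +-congˡ (-‿cong (*-comm (X n) (1# - q))) ⟩
      1# - (1# - q) * X n                ≈⟨ q^n≈ n ⟨
      q ^ n                              ∎

    geometric-polynomial : ∀ w → 0 < w → PolynomialIn X (λ n → ∑[ a < n ] (q ^ (w ℕ.* suc (toℕ a))))
    geometric-polynomial w w>0 = (gρ ∷ []) +ₚ -ₚ ((gρ ∷ []) *ₚ linear ^ₚ w) , λ n → begin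
      eval ((gρ ∷ []) +ₚ -ₚ ((gρ ∷ []) *ₚ linear ^ₚ w)) (X n)
        ≈⟨ eval-+ₚ (gρ ∷ []) (-ₚ ((gρ ∷ []) *ₚ linear ^ₚ w)) (X n) ⟩
      eval (gρ ∷ []) (X n) + eval (-ₚ ((gρ ∷ []) *ₚ linear ^ₚ w)) (X n)
        ≈⟨ +-cong (eval-const gρ (X n))
                  (trans (eval-negₚ ((gρ ∷ []) *ₚ linear ^ₚ w) (X n)) (-‿cong (eval-*ₚ (gρ ∷ []) (linear ^ₚ w) (X n)))) ⟩
      gρ - eval (gρ ∷ []) (X n) * eval (linear ^ₚ w) (X n)
        ≈⟨ +-congˡ (-‿cong (*-cong (eval-const gρ (X n)) (trans (eval-^ₚ linear w (X n)) (^-congˡ w (eval-linear n))))) ⟩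
      gρ - gρ * (q ^ n) ^ w
        ≈⟨ +-congˡ (-‿cong (*-congˡ (q^n^w≈ρ^n n))) ⟩
      gρ - gρ * ρ ^ n
        ≈⟨ +-congˡ (-‿cong (*-assoc g ρ (ρ ^ n))) ⟩
      gρ - g * ρ ^ suc n
        ≈⟨ geometric-sum ρ g g[1-ρ]≈1 n ⟨
      ∑[ a < n ] (ρ ^ suc (toℕ a))
        ≈⟨ sum-cong-≋ {n} (λ a → ^-assocʳ q w (suc (toℕ a))) ⟩
      ∑[ a < n ] (q ^ (w ℕ.* suc (toℕ a)))
        ∎
      where
      ρ g gρ : Carrier
      ρ = q ^ w
      g = proj₁ (1-q^w-invertible w w>0)
      gρ = g * ρ
      g[1-ρ]≈1 : g * (1# - ρ) ≈ 1#
      g[1-ρ]≈1 = proj₂ (1-q^w-invertible w w>0)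
      q^n^w≈ρ^n : ∀ n → (q ^ n) ^ w ≈ ρ ^ n
      q^n^w≈ρ^n n = trans (^-assocʳ q n w) (trans (reflexive (≡.cong (q ^_) (ℕP.*-comm n w))) (sym (^-assocʳ q w n)))

    -- Constraints are consumed from the front of L; those avoiding vertex 0 are shifted to
    -- M, and an edge at vertex 0 is removed by deletion–contraction, which lowers v.
    χ-polynomial : ∀ v (L : List (Constraint v)) wt → (∀ i → 0 < wt i) → PolynomialIn X (χ L wt)
    χ-polynomial-sweep : ∀ v (L : List (Constraint (suc v))) M wt → (∀ i → 0 < wt i) →
                         PolynomialIn X (χ (L ++ map ↑ M) wt)
    χ-polynomial-edge₀ : ∀ v j (L : List (Constraint (suc v))) M wt → (∀ i → 0 < wt i) →
                         PolynomialIn X (χ ((true , zero , suc j) ∷ L ++ map ↑ M) wt)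

    χ-polynomial zero    []                wt wt>0 =
      PolynomialIn-cong (λ n → sym (trans (+-identityʳ _) (*-identityˡ 1#))) (PolynomialIn-const 1#)
    χ-polynomial zero    ((_ , () , _) ∷ _) wt wt>0
    χ-polynomial (suc v) L                 wt wt>0 =
      ≡.subst (λ K → PolynomialIn X (χ K wt)) (++-identityʳ L) (χ-polynomial-sweep v L [] wt wt>0)

    χ-polynomial-sweep v [] M wt wt>0 =
      PolynomialIn-cong (λ n → sym (χ-↑ M wt n))
        (PolynomialIn-* (χ-polynomial v M (wt ∘ suc) (wt>0 ∘ suc)) (geometric-polynomial (wt zero) (wt>0 zero)))
    χ-polynomial-sweep v ((false , _ , _) ∷ L) M wt wt>0 = χ-polynomial-sweep v L M wt wt>0
    χ-polynomial-sweep v ((true , zero , zero) ∷ L) M wt wt>0 =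
      PolynomialIn-cong (λ n → sym (χ-loop zero (L ++ map ↑ M) wt n)) (PolynomialIn-const 0#)
    χ-polynomial-sweep v ((true , zero , suc j) ∷ L) M wt wt>0 = χ-polynomial-edge₀ v j L M wt wt>0
    χ-polynomial-sweep v ((true , suc i , zero) ∷ L) M wt wt>0 =
      PolynomialIn-cong (χ-swap true zero (suc i) (L ++ map ↑ M) wt) (χ-polynomial-edge₀ v i L M wt wt>0)
    χ-polynomial-sweep v ((true , suc i , suc j) ∷ L) M wt wt>0 =
      PolynomialIn-cong (χ-cong (L ++ map ↑ ((true , i , j) ∷ M)) ((true , suc i , suc j) ∷ L ++ map ↑ M)
                          (λ c → ≡.sym (⊨*-∷-++ c (true , suc i , suc j) L (map ↑ M))) wt)
        (χ-polynomial-sweep v L ((true , i , j) ∷ M) wt wt>0)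

    χ-polynomial-edge₀ v j L M wt wt>0 =
      PolynomialIn-difference (χ-polynomial v (contract j K) (contractWeight wt j) (contractWeight-pos wt j wt>0))
                              (χ-polynomial-sweep v L M wt wt>0)
                              (χ-delete-contract j K wt)
      where K : List (Constraint (suc v))
            K = L ++ map ↑ M

module ℚ[q] where

  open ≡

  open import Data.Rational.Solver using (module +-*-Solver)
  open +-*-Solver using (_:=_; _:+_; _:*_) renaming (solve to solveℚ)
  coeffQ-0∷[] : ∀ i → coeffQ (0ℚ ∷ []) i ≡ 0ℚ
  coeffQ-0∷[] zero    = refl
  coeffQ-0∷[] (suc i) = refl

  ∷-cong : ∀ {a b p r} → a ≡ b → p ≈P r → (a ∷ p) ≈P (b ∷ r)
  ∷-cong a≡b p≈r zero    = a≡b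
  ∷-cong a≡b p≈r (suc i) = p≈r i

  coeffQ-+P : ∀ p r i → coeffQ (p +P r) i ≡ coeffQ p i ℚ.+ coeffQ r i
  coeffQ-+P []      r       i       = sym (ℚP.+-identityˡ _)
  coeffQ-+P (a ∷ p) []      zero    = sym (ℚP.+-identityʳ a)
  coeffQ-+P (a ∷ p) []      (suc i) = sym (ℚP.+-identityʳ _)
  coeffQ-+P (a ∷ p) (b ∷ r) zero    = refl
  coeffQ-+P (a ∷ p) (b ∷ r) (suc i) = coeffQ-+P p r i

  coeffQ-scaleP : ∀ a p i → coeffQ (scaleP a p) i ≡ a ℚ.* coeffQ p i
  coeffQ-scaleP a []      i       = sym (ℚP.*-zeroʳ a)
  coeffQ-scaleP a (b ∷ p) zero    = refl
  coeffQ-scaleP a (b ∷ p) (suc i) = coeffQ-scaleP a p i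

  coeffQ-negP : ∀ p i → coeffQ (negP p) i ≡ ℚ.- coeffQ p i
  coeffQ-negP []      i       = refl
  coeffQ-negP (b ∷ p) zero    = refl
  coeffQ-negP (b ∷ p) (suc i) = coeffQ-negP p i

  coeffQ-∷*P : ∀ a p r i → coeffQ ((a ∷ p) *P r) i ≡ a ℚ.* coeffQ r i ℚ.+ coeffQ (0ℚ ∷ p *P r) i
  coeffQ-∷*P a p r i = trans (coeffQ-+P (scaleP a r) (0ℚ ∷ p *P r) i) (cong (ℚ._+ _) (coeffQ-scaleP a r i))

  -- Holds because 0ℚ ℚ.+ 0ℚ evaluates to 0ℚ.
  coeffQ-0∷+P : ∀ p r i → coeffQ (0ℚ ∷ p +P r) i ≡ coeffQ (0ℚ ∷ p) i ℚ.+ coeffQ (0ℚ ∷ r) i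
  coeffQ-0∷+P p r = coeffQ-+P (0ℚ ∷ p) (0ℚ ∷ r)

  +P-cong : ∀ {p p′ r r′} → p ≈P p′ → r ≈P r′ → (p +P r) ≈P (p′ +P r′)
  +P-cong {p} {p′} {r} {r′} p≈p′ r≈r′ i =
    trans (coeffQ-+P p r i) (trans (cong₂ ℚ._+_ (p≈p′ i) (r≈r′ i)) (sym (coeffQ-+P p′ r′ i)))

  +P-comm : ∀ p r → (p +P r) ≈P (r +P p)
  +P-comm p r i = trans (coeffQ-+P p r i) (trans (ℚP.+-comm (coeffQ p i) (coeffQ r i)) (sym (coeffQ-+P r p i)))

  +P-assoc : ∀ p r s → ((p +P r) +P s) ≈P (p +P (r +P s))
  +P-assoc p r s i = begin
    coeffQ ((p +P r) +P s) i                    ≡⟨ coeffQ-+P (p +P r) s i ⟩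
    coeffQ (p +P r) i ℚ.+ coeffQ s i            ≡⟨ cong (ℚ._+ coeffQ s i) (coeffQ-+P p r i) ⟩
    (coeffQ p i ℚ.+ coeffQ r i) ℚ.+ coeffQ s i  ≡⟨ ℚP.+-assoc (coeffQ p i) _ _ ⟩
    coeffQ p i ℚ.+ (coeffQ r i ℚ.+ coeffQ s i)  ≡⟨ cong (coeffQ p i ℚ.+_) (coeffQ-+P r s i) ⟨
    coeffQ p i ℚ.+ coeffQ (r +P s) i            ≡⟨ coeffQ-+P p (r +P s) i ⟨
    coeffQ (p +P (r +P s)) i                    ∎
    where open ≡-Reasoning

  +P-identityʳ : ∀ p → (p +P []) ≈P p
  +P-identityʳ p i = trans (coeffQ-+P p [] i) (ℚP.+-identityʳ _)

  negP-cong : ∀ {p r} → p ≈P r → negP p ≈P negP r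
  negP-cong {p} {r} p≈r i = trans (coeffQ-negP p i) (trans (cong ℚ.-_ (p≈r i)) (sym (coeffQ-negP r i)))

  +P-inverseˡ : ∀ p → (negP p +P p) ≈P []
  +P-inverseˡ p i = trans (coeffQ-+P (negP p) p i)
    (trans (cong (ℚ._+ coeffQ p i) (coeffQ-negP p i)) (ℚP.+-inverseˡ (coeffQ p i)))

  +P-inverseʳ : ∀ p → (p +P negP p) ≈P []
  +P-inverseʳ p i = trans (+P-comm p (negP p) i) (+P-inverseˡ p i)

  *P-zeroʳ : ∀ p → (p *P []) ≈P []
  *P-zeroʳ []      i       = refl
  *P-zeroʳ (a ∷ p) zero    = refl
  *P-zeroʳ (a ∷ p) (suc i) = *P-zeroʳ p i

  *P-congʳ : ∀ p {r r′} → r ≈P r′ → (p *P r) ≈P (p *P r′)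
  *P-congʳ []      r≈r′ i = refl
  *P-congʳ (a ∷ p) {r} {r′} r≈r′ i = begin
    coeffQ ((a ∷ p) *P r) i
      ≡⟨ coeffQ-∷*P a p r i ⟩
    a ℚ.* coeffQ r i ℚ.+ coeffQ (0ℚ ∷ p *P r) i
      ≡⟨ cong₂ (λ u v → a ℚ.* u ℚ.+ v) (r≈r′ i) (∷-cong refl (*P-congʳ p r≈r′) i) ⟩
    a ℚ.* coeffQ r′ i ℚ.+ coeffQ (0ℚ ∷ p *P r′) i
      ≡⟨ coeffQ-∷*P a p r′ i ⟨
    coeffQ ((a ∷ p) *P r′) i
      ∎
    where open ≡-Reasoning

  coeffQ-*P∷ : ∀ p b r i → coeffQ (p *P (b ∷ r)) i ≡ b ℚ.* coeffQ p i ℚ.+ coeffQ (0ℚ ∷ p *P r) i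
  coeffQ-*P∷ []      b r i       =
    sym (trans (cong₂ ℚ._+_ (ℚP.*-zeroʳ b) (coeffQ-0∷[] i)) (ℚP.+-identityʳ 0ℚ))
  coeffQ-*P∷ (a ∷ p) b r zero    = trans (coeffQ-∷*P a p (b ∷ r) zero) (cong (ℚ._+ 0ℚ) (ℚP.*-comm a b))
  coeffQ-*P∷ (a ∷ p) b r (suc i) = begin
    coeffQ ((a ∷ p) *P (b ∷ r)) (suc i)
      ≡⟨ coeffQ-∷*P a p (b ∷ r) (suc i) ⟩
    a ℚ.* coeffQ r i ℚ.+ coeffQ (p *P (b ∷ r)) i
      ≡⟨ cong (a ℚ.* coeffQ r i ℚ.+_) (coeffQ-*P∷ p b r i) ⟩
    a ℚ.* coeffQ r i ℚ.+ (b ℚ.* coeffQ p i ℚ.+ coeffQ (0ℚ ∷ p *P r) i)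
      ≡⟨ solveℚ 5 (λ x y z w u → x :* y :+ (z :* w :+ u) := z :* w :+ (x :* y :+ u)) refl a (coeffQ r i) b (coeffQ p i) _ ⟩
    b ℚ.* coeffQ p i ℚ.+ (a ℚ.* coeffQ r i ℚ.+ coeffQ (0ℚ ∷ p *P r) i)
      ≡⟨ cong (b ℚ.* coeffQ p i ℚ.+_) (coeffQ-∷*P a p r i) ⟨
    b ℚ.* coeffQ p i ℚ.+ coeffQ ((a ∷ p) *P r) i
      ∎
    where open ≡-Reasoning

  *P-comm : ∀ p r → (p *P r) ≈P (r *P p)
  *P-comm []      r i = sym (*P-zeroʳ r i)
  *P-comm (a ∷ p) r i = begin
    coeffQ ((a ∷ p) *P r) i                        ≡⟨ coeffQ-∷*P a p r i ⟩
    a ℚ.* coeffQ r i ℚ.+ coeffQ (0ℚ ∷ p *P r) i    ≡⟨ cong (a ℚ.* coeffQ r i ℚ.+_) (∷-cong refl (*P-comm p r) i) ⟩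
    a ℚ.* coeffQ r i ℚ.+ coeffQ (0ℚ ∷ r *P p) i    ≡⟨ coeffQ-*P∷ r a p i ⟨
    coeffQ (r *P (a ∷ p)) i                        ∎
    where open ≡-Reasoning

  *P-congˡ : ∀ {p p′} r → p ≈P p′ → (p *P r) ≈P (p′ *P r)
  *P-congˡ {p} {p′} r p≈p′ i = trans (*P-comm p r i) (trans (*P-congʳ r {p} {p′} p≈p′ i) (*P-comm r p′ i))

  *P-cong : ∀ {p p′ r r′} → p ≈P p′ → r ≈P r′ → (p *P r) ≈P (p′ *P r′)
  *P-cong {p} {p′} {r} {r′} p≈p′ r≈r′ i = trans (*P-congˡ {p} {p′} r p≈p′ i) (*P-congʳ p′ {r} {r′} r≈r′ i)

  *P-distribˡ : ∀ p r s → (p *P (r +P s)) ≈P ((p *P r) +P (p *P s))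
  *P-distribˡ []      r s i = refl
  *P-distribˡ (a ∷ p) r s i = begin
    coeffQ ((a ∷ p) *P (r +P s)) i
      ≡⟨ coeffQ-∷*P a p (r +P s) i ⟩
    a ℚ.* coeffQ (r +P s) i ℚ.+ coeffQ (0ℚ ∷ p *P (r +P s)) i
      ≡⟨ cong₂ (λ u v → a ℚ.* u ℚ.+ v) (coeffQ-+P r s i)
               (trans (∷-cong refl (*P-distribˡ p r s) i) (coeffQ-0∷+P (p *P r) (p *P s) i)) ⟩
    a ℚ.* (coeffQ r i ℚ.+ coeffQ s i) ℚ.+ (coeffQ (0ℚ ∷ p *P r) i ℚ.+ coeffQ (0ℚ ∷ p *P s) i)
      ≡⟨ solveℚ 5 (λ x y z u v → x :* (y :+ z) :+ (u :+ v) := (x :* y :+ u) :+ (x :* z :+ v)) refl a (coeffQ r i) (coeffQ s i) _ _ ⟩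
    (a ℚ.* coeffQ r i ℚ.+ coeffQ (0ℚ ∷ p *P r) i) ℚ.+ (a ℚ.* coeffQ s i ℚ.+ coeffQ (0ℚ ∷ p *P s) i)
      ≡⟨ cong₂ ℚ._+_ (coeffQ-∷*P a p r i) (coeffQ-∷*P a p s i) ⟨
    coeffQ ((a ∷ p) *P r) i ℚ.+ coeffQ ((a ∷ p) *P s) i
      ≡⟨ coeffQ-+P ((a ∷ p) *P r) ((a ∷ p) *P s) i ⟨
    coeffQ (((a ∷ p) *P r) +P ((a ∷ p) *P s)) i
      ∎
    where open ≡-Reasoning

  *P-distribʳ : ∀ p r s → ((r +P s) *P p) ≈P ((r *P p) +P (s *P p))
  *P-distribʳ p r s i = begin
    coeffQ ((r +P s) *P p) i             ≡⟨ *P-comm (r +P s) p i ⟩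
    coeffQ (p *P (r +P s)) i             ≡⟨ *P-distribˡ p r s i ⟩
    coeffQ ((p *P r) +P (p *P s)) i      ≡⟨ +P-cong {p *P r} {r *P p} {p *P s} {s *P p} (*P-comm p r) (*P-comm p s) i ⟩
    coeffQ ((r *P p) +P (s *P p)) i      ∎
    where open ≡-Reasoning

  scaleP-*P : ∀ a r s → (scaleP a r *P s) ≈P scaleP a (r *P s)
  scaleP-*P a []      s i = refl
  scaleP-*P a (b ∷ r) s i = begin
    coeffQ ((a ℚ.* b ∷ scaleP a r) *P s) i
      ≡⟨ coeffQ-∷*P (a ℚ.* b) (scaleP a r) s i ⟩
    (a ℚ.* b) ℚ.* coeffQ s i ℚ.+ coeffQ (0ℚ ∷ scaleP a r *P s) i
      ≡⟨ cong ((a ℚ.* b) ℚ.* coeffQ s i ℚ.+_)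
              (trans (∷-cong (sym (ℚP.*-zeroʳ a)) (scaleP-*P a r s) i) (coeffQ-scaleP a (0ℚ ∷ r *P s) i)) ⟩
    (a ℚ.* b) ℚ.* coeffQ s i ℚ.+ a ℚ.* coeffQ (0ℚ ∷ r *P s) i
      ≡⟨ solveℚ 4 (λ x y z u → (x :* y) :* z :+ x :* u := x :* (y :* z :+ u)) refl a b (coeffQ s i) _ ⟩
    a ℚ.* (b ℚ.* coeffQ s i ℚ.+ coeffQ (0ℚ ∷ r *P s) i)
      ≡⟨ cong (a ℚ.*_) (coeffQ-∷*P b r s i) ⟨
    a ℚ.* coeffQ ((b ∷ r) *P s) i
      ≡⟨ coeffQ-scaleP a ((b ∷ r) *P s) i ⟨
    coeffQ (scaleP a ((b ∷ r) *P s)) i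
      ∎
    where open ≡-Reasoning

  0∷-*P : ∀ p s → ((0ℚ ∷ p) *P s) ≈P (0ℚ ∷ p *P s)
  0∷-*P p s i = trans (coeffQ-∷*P 0ℚ p s i)
    (trans (cong (ℚ._+ coeffQ (0ℚ ∷ p *P s) i) (ℚP.*-zeroˡ (coeffQ s i))) (ℚP.+-identityˡ _))

  *P-assoc : ∀ p r s → ((p *P r) *P s) ≈P (p *P (r *P s))
  *P-assoc []      r s i = refl
  *P-assoc (a ∷ p) r s i = begin
    coeffQ ((scaleP a r +P (0ℚ ∷ p *P r)) *P s) i
      ≡⟨ *P-distribʳ s (scaleP a r) (0ℚ ∷ p *P r) i ⟩
    coeffQ ((scaleP a r *P s) +P ((0ℚ ∷ p *P r) *P s)) i
      ≡⟨ +P-cong {scaleP a r *P s} {scaleP a (r *P s)} {(0ℚ ∷ p *P r) *P s} {0ℚ ∷ p *P (r *P s)}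
                 (scaleP-*P a r s) (λ j → trans (0∷-*P (p *P r) s j) (∷-cong refl (*P-assoc p r s) j)) i ⟩
    coeffQ (scaleP a (r *P s) +P (0ℚ ∷ p *P (r *P s))) i
      ∎
    where open ≡-Reasoning

  1P : PolyQ
  1P = 1ℚ ∷ []

  *P-identityˡ : ∀ p → (1P *P p) ≈P p
  *P-identityˡ p i = trans (coeffQ-∷*P 1ℚ [] p i)
    (trans (cong₂ ℚ._+_ (ℚP.*-identityˡ (coeffQ p i)) (coeffQ-0∷[] i)) (ℚP.+-identityʳ _))

  *P-identityʳ : ∀ p → (p *P 1P) ≈P p
  *P-identityʳ p i = trans (*P-comm p 1P i) (*P-identityˡ p i)

  -- ≈P wrapped in a record, so that its arguments can be inferred by unification.
  infix 4 _≋_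
  record _≋_ (p r : PolyQ) : Set where
    constructor mk≋
    field get≋ : p ≈P r
  open _≋_ public

  open import Algebra.Structures {A = PolyQ} _≋_ using (IsCommutativeRing)

  ℚ[q]-isCommutativeRing : IsCommutativeRing _+P_ _*P_ negP [] 1P
  ℚ[q]-isCommutativeRing = record
    { isRing = record
      { +-isAbelianGroup = record
        { isGroup = record
          { isMonoid = record
            { isSemigroup = record
              { isMagma = record
                { isEquivalence = record
                  { refl  = mk≋ (λ _ → refl)
                  ; sym   = λ p≋r → mk≋ (λ i → sym (get≋ p≋r i))
                  ; trans = λ p≋r r≋s → mk≋ (λ i → trans (get≋ p≋r i) (get≋ r≋s i))
                  }
                ; ∙-cong = λ {p} {p′} {r} {r′} p≋p′ r≋r′ → mk≋ (+P-cong {p} {p′} {r} {r′} (get≋ p≋p′) (get≋ r≋r′))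
                }
              ; assoc = λ p r s → mk≋ (+P-assoc p r s)
              }
            ; identity = (λ p → mk≋ (λ _ → refl)) , (λ p → mk≋ (+P-identityʳ p))
            }
          ; inverse = (λ p → mk≋ (+P-inverseˡ p)) , (λ p → mk≋ (+P-inverseʳ p))
          ; ⁻¹-cong = λ {p} {r} p≋r → mk≋ (negP-cong {p} {r} (get≋ p≋r))
          }
        ; comm = λ p r → mk≋ (+P-comm p r)
        }
      ; *-cong     = λ {p} {p′} {r} {r′} p≋p′ r≋r′ → mk≋ (*P-cong {p} {p′} {r} {r′} (get≋ p≋p′) (get≋ r≋r′))
      ; *-assoc    = λ p r s → mk≋ (*P-assoc p r s)
      ; *-identity = (λ p → mk≋ (*P-identityˡ p)) , (λ p → mk≋ (*P-identityʳ p))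
      ; distrib    = (λ p r s → mk≋ (*P-distribˡ p r s)) , (λ p r s → mk≋ (*P-distribʳ p r s))
      }
    ; *-comm = λ p r → mk≋ (*P-comm p r)
    }

  ℚ[q]-commutativeRing : CommutativeRing 0ℓ 0ℓ
  ℚ[q]-commutativeRing = record { isCommutativeRing = ℚ[q]-isCommutativeRing }

  ≈P[]-∷ : ∀ {a p} → a ≡ 0ℚ → p ≈P [] → (a ∷ p) ≈P []
  ≈P[]-∷ a≡0 p≈[] zero    = a≡0
  ≈P[]-∷ a≡0 p≈[] (suc i) = p≈[] i

  ∷-≈P[]-tail : ∀ {a p} → (a ∷ p) ≈P [] → p ≈P []
  ∷-≈P[]-tail a∷p≈[] i = a∷p≈[] (suc i)

  ≈P[]? : (p : PolyQ) → Dec (p ≈P [])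
  ≈P[]? []      = yes (λ _ → refl)
  ≈P[]? (a ∷ p) with a ℚ.≟ 0ℚ | ≈P[]? p
  ... | yes a≡0 | yes p≈[] = yes (≈P[]-∷ a≡0 p≈[])
  ... | no  a≢0 | _        = no (λ a∷p≈[] → a≢0 (a∷p≈[] zero))
  ... | yes _   | no  p≉[] = no (λ a∷p≈[] → p≉[] (∷-≈P[]-tail a∷p≈[]))

  ℚ[q]-almostCommutativeRing : AlmostCommutativeRing 0ℓ 0ℓ
  ℚ[q]-almostCommutativeRing = fromCommutativeRing ℚ[q]-commutativeRing 0≋?
    where 0≋? : ∀ p → Maybe ([] ≋ p)
          0≋? p with ≈P[]? p
          ... | yes p≈[] = just (mk≋ (λ i → sym (p≈[] i)))
          ... | no  _    = nothing

  *-≢0 : ∀ {a b} → a ≢ 0ℚ → b ≢ 0ℚ → a ℚ.* b ≢ 0ℚ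
  *-≢0 {a} {b} a≢0 b≢0 ab≡0 = b≢0 (begin
      b                      ≡⟨ ℚP.*-identityˡ b ⟨
      1ℚ ℚ.* b               ≡⟨ cong (ℚ._* b) (ℚP.*-inverseˡ a) ⟨
      (ℚ.1/ a ℚ.* a) ℚ.* b   ≡⟨ ℚP.*-assoc (ℚ.1/ a) a b ⟩
      ℚ.1/ a ℚ.* (a ℚ.* b)   ≡⟨ cong (ℚ.1/ a ℚ.*_) ab≡0 ⟩
      ℚ.1/ a ℚ.* 0ℚ          ≡⟨ ℚP.*-zeroʳ (ℚ.1/ a) ⟩
      0ℚ                     ∎)
    where
      open ≡-Reasoning
      instance _ = ℚ.≢-nonZero a≢0

  lowestTerm : ∀ p → ¬ (p ≈P []) →
               ∃ λ k → ∃₂ λ a p′ → a ≢ 0ℚ × p ≡ replicate k 0ℚ ++ (a ∷ p′)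
  lowestTerm []      p≉[] = ⊥-elim (p≉[] (λ _ → refl))
  lowestTerm (a ∷ p) a∷p≉[] with a ℚ.≟ 0ℚ
  ... | no  a≢0 = 0 , a , p , a≢0 , refl
  ... | yes refl with lowestTerm p (λ p≈[] → a∷p≉[] (≈P[]-∷ refl p≈[]))
  ...   | k , b , p′ , b≢0 , p≡ = suc k , b , p′ , b≢0 , cong (0ℚ ∷_) p≡

  coeffQ-shift-*P : ∀ k u r j → coeffQ ((replicate k 0ℚ ++ u) *P r) (k ℕ.+ j) ≡ coeffQ (u *P r) j
  coeffQ-shift-*P zero    u r j = refl
  coeffQ-shift-*P (suc k) u r j = trans (0∷-*P (replicate k 0ℚ ++ u) r (suc (k ℕ.+ j))) (coeffQ-shift-*P k u r j)

  -- The product of the lowest terms a q^k and b q^l is the nonzero term a b q^(k+l).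
  *P-≉[] : ∀ p r → ¬ (p ≈P []) → ¬ (r ≈P []) → ¬ ((p *P r) ≈P [])
  *P-≉[] p r p≉[] r≉[] pr≈[] with lowestTerm p p≉[] | lowestTerm r r≉[]
  ... | k , a , p′ , a≢0 , refl | l , b , r′ , b≢0 , refl = *-≢0 a≢0 b≢0 (begin
      a ℚ.* b                                   ≡⟨ ℚP.+-identityʳ (a ℚ.* b) ⟨
      a ℚ.* b ℚ.+ 0ℚ                            ≡⟨ coeffQ-∷*P a p′ (b ∷ r′) zero ⟨
      coeffQ ((a ∷ p′) *P (b ∷ r′)) 0           ≡⟨ *P-comm (a ∷ p′) (b ∷ r′) 0 ⟩
      coeffQ ((b ∷ r′) *P (a ∷ p′)) 0           ≡⟨ coeffQ-shift-*P l (b ∷ r′) (a ∷ p′) 0 ⟨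
      coeffQ (r *P (a ∷ p′)) (l ℕ.+ 0)          ≡⟨ cong (coeffQ (r *P (a ∷ p′))) (ℕP.+-identityʳ l) ⟩
      coeffQ (r *P (a ∷ p′)) l                  ≡⟨ *P-comm r (a ∷ p′) l ⟩
      coeffQ ((a ∷ p′) *P r) l                  ≡⟨ coeffQ-shift-*P k (a ∷ p′) r l ⟨
      coeffQ (p *P r) (k ℕ.+ l)                 ≡⟨ pr≈[] (k ℕ.+ l) ⟩
      0ℚ                                        ∎)
    where open ≡-Reasoning

  import Tactic.RingSolver.NonReflective
  module ℚ[q]-Solver = Tactic.RingSolver.NonReflective ℚ[q]-almostCommutativeRing

  *P-cancelʳ : ∀ c a b → ¬ (c ≈P []) → (a *P c) ≋ (b *P c) → a ≋ b
  *P-cancelʳ c a b c≉[] ac≋bc = byCases (≈P[]? (a +P negP b))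
    where
    module R = CommutativeRing ℚ[q]-commutativeRing
    open import Relation.Binary.Reasoning.Setoid R.setoid
    open import Algebra.Properties.Group R.+-group using (x∙y⁻¹≈ε⇒x≈y)
    open ℚ[q]-Solver using (solve; _⊜_; _⊕_; _⊗_; ⊝_)

    byCases : Dec ((a +P negP b) ≈P []) → a ≋ b
    byCases (yes a-b≈[]) = x∙y⁻¹≈ε⇒x≈y a b (mk≋ a-b≈[])
    byCases (no  a-b≉[]) = ⊥-elim (*P-≉[] (a +P negP b) c a-b≉[] c≉[] (get≋ (begin
      (a +P negP b) *P c             ≈⟨ solve 3 (λ a b c → ((a ⊕ (⊝ b)) ⊗ c) ⊜ ((a ⊗ c) ⊕ (⊝ (b ⊗ c)))) R.refl a b c ⟩
      (a *P c) +P negP (b *P c)      ≈⟨ R.+-congʳ ac≋bc ⟩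
      (b *P c) +P negP (b *P c)      ≈⟨ R.-‿inverseʳ (b *P c) ⟩
      []                             ∎)))

  qPow-suc : ∀ k → qPow (suc k) ≋ qPow 1 *P qPow k
  qPow-suc k = mk≋ (λ i → sym (trans (0∷-*P (1ℚ ∷ []) (qPow k) i) (∷-cong refl (*P-identityˡ (qPow k)) i)))

  coeffQ-qPow-≡ : ∀ k → coeffQ (qPow k) k ≡ 1ℚ
  coeffQ-qPow-≡ zero    = refl
  coeffQ-qPow-≡ (suc k) = coeffQ-qPow-≡ k

  coeffQ-qPow-≢ : ∀ k i → k ≢ i → coeffQ (qPow k) i ≡ 0ℚ
  coeffQ-qPow-≢ zero    zero    k≢i = ⊥-elim (k≢i refl)
  coeffQ-qPow-≢ zero    (suc i) k≢i = refl
  coeffQ-qPow-≢ (suc k) zero    k≢i = refl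
  coeffQ-qPow-≢ (suc k) (suc i) k≢i = coeffQ-qPow-≢ k i (k≢i ∘ cong suc)

  1-q^_ : ℕ → PolyQ
  1-q^ k = 1P +P negP (qPow k)

  1-q^suc-≉[] : ∀ k → ¬ ((1-q^ suc k) ≈P [])
  1-q^suc-≉[] k 1-q^k+1≈[] = -1≢0 (begin
    ℚ.- 1ℚ                          ≡⟨ cong ℚ.-_ (coeffQ-qPow-≡ k) ⟨
    ℚ.- coeffQ (qPow k) k           ≡⟨ coeffQ-negP (qPow k) k ⟨
    coeffQ (1-q^ suc k) (suc k)     ≡⟨ 1-q^k+1≈[] (suc k) ⟩
    0ℚ                              ∎)
    where open ≡-Reasoning
          -1≢0 : ℚ.- 1ℚ ≢ 0ℚ
          -1≢0 ()

  1-q^suc-injective : ∀ {k l} → (1-q^ suc k) ≋ (1-q^ suc l) → k ≡ l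
  1-q^suc-injective {k} {l} (mk≋ eq) with k ℕ.≟ l
  ... | yes k≡l = k≡l
  ... | no  k≢l = ⊥-elim (-1≢-0 (begin
    ℚ.- 1ℚ                          ≡⟨ cong ℚ.-_ (coeffQ-qPow-≡ k) ⟨
    ℚ.- coeffQ (qPow k) k           ≡⟨ coeffQ-negP (qPow k) k ⟨
    coeffQ (1-q^ suc k) (suc k)     ≡⟨ eq (suc k) ⟩
    coeffQ (1-q^ suc l) (suc k)     ≡⟨ coeffQ-negP (qPow l) k ⟩
    ℚ.- coeffQ (qPow l) k           ≡⟨ cong ℚ.-_ (coeffQ-qPow-≢ l k (k≢l ∘ sym)) ⟩
    ℚ.- 0ℚ                          ∎))
    where open ≡-Reasoning
          -1≢-0 : ℚ.- 1ℚ ≢ ℚ.- 0ℚ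
          -1≢-0 ()

module ℚ⟨q⟩ where

  open ℚ[q]
  open ℚ[q]-Solver using (solve; _⊜_; _⊕_; _⊗_; ⊝_; Κ)
  private module P = CommutativeRing ℚ[q]-commutativeRing

  ℚ⟨q⟩ : Set
  ℚ⟨q⟩ = Σ RatFun ValidF

  nm dn : ℚ⟨q⟩ → PolyQ
  nm x = num (proj₁ x)
  dn x = den (proj₁ x)

  infix 4 _≃_
  record _≃_ (x y : ℚ⟨q⟩) : Set where
    constructor mk≃
    field get≃ : proj₁ x ≈F proj₁ y
  open _≃_ public

  cross : ∀ {x y} → (nm x *P dn y) ≋ (nm y *P dn x) → x ≃ y
  cross (mk≋ eq) = mk≃ eq

  uncross : ∀ {x y} → x ≃ y → (nm x *P dn y) ≋ (nm y *P dn x)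
  uncross (mk≃ eq) = mk≋ eq

  1P-≉[] : ¬ (1P ≈P [])
  1P-≉[] 1≈0 = ℚP.1≢0 (1≈0 zero)

  infixl 6 _+K_
  infixl 7 _*K_

  _+K_ : ℚ⟨q⟩ → ℚ⟨q⟩ → ℚ⟨q⟩
  x +K y = (proj₁ x +F proj₁ y) , *P-≉[] (dn x) (dn y) (proj₂ x) (proj₂ y)

  _*K_ : ℚ⟨q⟩ → ℚ⟨q⟩ → ℚ⟨q⟩
  x *K y = (proj₁ x *F proj₁ y) , *P-≉[] (dn x) (dn y) (proj₂ x) (proj₂ y)

  -K_ : ℚ⟨q⟩ → ℚ⟨q⟩
  -K x = (negP (nm x) / dn x) , proj₂ x

  ι : PolyQ → ℚ⟨q⟩
  ι p = fromPolyQ p , 1P-≉[]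

  0K 1K : ℚ⟨q⟩
  0K = ι []
  1K = ι 1P

  ≃-trans : ∀ {x y z} → x ≃ y → y ≃ z → x ≃ z
  ≃-trans {x} {y} {z} x≃y y≃z = cross (*P-cancelʳ (dn y) (nm x *P dn z) (nm z *P dn x) (proj₂ y) (begin
    (nm x *P dn z) *P dn y  ≈⟨ swap₂₃ (nm x) (dn z) (dn y) ⟩
    (nm x *P dn y) *P dn z  ≈⟨ P.*-congʳ (uncross x≃y) ⟩
    (nm y *P dn x) *P dn z  ≈⟨ swap₂₃ (nm y) (dn x) (dn z) ⟩
    (nm y *P dn z) *P dn x  ≈⟨ P.*-congʳ (uncross y≃z) ⟩
    (nm z *P dn y) *P dn x  ≈⟨ swap₂₃ (nm z) (dn y) (dn x) ⟩
    (nm z *P dn x) *P dn y  ∎))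
    where open import Relation.Binary.Reasoning.Setoid P.setoid
          swap₂₃ : ∀ a b c → ((a *P b) *P c) ≋ ((a *P c) *P b)
          swap₂₃ = solve 3 (λ a b c → ((a ⊗ b) ⊗ c) ⊜ ((a ⊗ c) ⊗ b)) P.refl

  +K-cong : ∀ {x x′ y y′} → x ≃ x′ → y ≃ y′ → x +K y ≃ x′ +K y′
  +K-cong {x} {x′} {y} {y′} x≃x′ y≃y′ = cross (begin
    (nm x *P dn y +P nm y *P dn x) *P (dn x′ *P dn y′)
      ≈⟨ solve 6 (λ a b c d e f → (((a ⊗ b) ⊕ (c ⊗ d)) ⊗ (e ⊗ f)) ⊜ (((a ⊗ e) ⊗ (b ⊗ f)) ⊕ ((c ⊗ f) ⊗ (d ⊗ e))))
               P.refl (nm x) (dn y) (nm y) (dn x) (dn x′) (dn y′) ⟩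
    (nm x *P dn x′) *P (dn y *P dn y′) +P (nm y *P dn y′) *P (dn x *P dn x′)
      ≈⟨ P.+-cong (P.*-congʳ (uncross x≃x′)) (P.*-congʳ (uncross y≃y′)) ⟩
    (nm x′ *P dn x) *P (dn y *P dn y′) +P (nm y′ *P dn y) *P (dn x *P dn x′)
      ≈⟨ solve 6 (λ a b c d e f → (((a ⊗ b) ⊗ (c ⊗ d)) ⊕ ((e ⊗ c) ⊗ (b ⊗ f))) ⊜ (((a ⊗ d) ⊕ (e ⊗ f)) ⊗ (b ⊗ c)))
               P.refl (nm x′) (dn x) (dn y) (dn y′) (nm y′) (dn x′) ⟩
    (nm x′ *P dn y′ +P nm y′ *P dn x′) *P (dn x *P dn y)
      ∎)
    where open import Relation.Binary.Reasoning.Setoid P.setoid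

  *K-cong : ∀ {x x′ y y′} → x ≃ x′ → y ≃ y′ → x *K y ≃ x′ *K y′
  *K-cong {x} {x′} {y} {y′} x≃x′ y≃y′ = cross (begin
    (nm x *P nm y) *P (dn x′ *P dn y′)    ≈⟨ interchange (nm x) (nm y) (dn x′) (dn y′) ⟩
    (nm x *P dn x′) *P (nm y *P dn y′)    ≈⟨ P.*-cong (uncross x≃x′) (uncross y≃y′) ⟩
    (nm x′ *P dn x) *P (nm y′ *P dn y)    ≈⟨ interchange (nm x′) (dn x) (nm y′) (dn y) ⟩
    (nm x′ *P nm y′) *P (dn x *P dn y)    ∎)
    where open import Relation.Binary.Reasoning.Setoid P.setoid
          interchange : ∀ a b c d → ((a *P b) *P (c *P d)) ≋ ((a *P c) *P (b *P d))
          interchange = solve 4 (λ a b c d → ((a ⊗ b) ⊗ (c ⊗ d)) ⊜ ((a ⊗ c) ⊗ (b ⊗ d))) P.refl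

  -K-cong : ∀ {x x′} → x ≃ x′ → -K x ≃ -K x′
  -K-cong {x} {x′} x≃x′ = cross (begin
    negP (nm x) *P dn x′      ≈⟨ solve 2 (λ a b → ((⊝ a) ⊗ b) ⊜ (⊝ (a ⊗ b))) P.refl (nm x) (dn x′) ⟩
    negP (nm x *P dn x′)      ≈⟨ P.-‿cong (uncross x≃x′) ⟩
    negP (nm x′ *P dn x)      ≈⟨ solve 2 (λ a b → (⊝ (a ⊗ b)) ⊜ ((⊝ a) ⊗ b)) P.refl (nm x′) (dn x) ⟩
    negP (nm x′) *P dn x      ∎)
    where open import Relation.Binary.Reasoning.Setoid P.setoid

  open import Algebra.Structures {A = ℚ⟨q⟩} _≃_ using (IsCommutativeRing)

  ℚ⟨q⟩-isCommutativeRing : IsCommutativeRing _+K_ _*K_ -K_ 0K 1K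
  ℚ⟨q⟩-isCommutativeRing = record
    { isRing = record
      { +-isAbelianGroup = record
        { isGroup = record
          { isMonoid = record
            { isSemigroup = record
              { isMagma = record
                { isEquivalence = record
                  { refl  = cross P.refl
                  ; sym   = λ x≃y → cross (P.sym (uncross x≃y))
                  ; trans = λ {x} {y} {z} → ≃-trans {x} {y} {z}
                  }
                ; ∙-cong = λ {x} {x′} {y} {y′} → +K-cong {x} {x′} {y} {y′}
                }
              ; assoc = λ x y z → cross (solve 6
                  (λ a b c d e f → ((((a ⊗ d) ⊕ (c ⊗ b)) ⊗ f ⊕ (e ⊗ (b ⊗ d))) ⊗ (b ⊗ (d ⊗ f)))
                                 ⊜ (((a ⊗ (d ⊗ f)) ⊕ (((c ⊗ f) ⊕ (e ⊗ d)) ⊗ b)) ⊗ ((b ⊗ d) ⊗ f)))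
                  P.refl (nm x) (dn x) (nm y) (dn y) (nm z) (dn z))
              }
            ; identity =
                (λ x → cross (solve 2 (λ a b → ((Κ [] ⊗ b ⊕ a ⊗ Κ 1P) ⊗ b) ⊜ (a ⊗ (Κ 1P ⊗ b))) P.refl (nm x) (dn x))) ,
                (λ x → cross (solve 2 (λ a b → ((a ⊗ Κ 1P ⊕ Κ [] ⊗ b) ⊗ b) ⊜ (a ⊗ (b ⊗ Κ 1P))) P.refl (nm x) (dn x)))
            }
          ; inverse =
              (λ x → cross (solve 2 (λ a b → ((((⊝ a) ⊗ b) ⊕ (a ⊗ b)) ⊗ Κ 1P) ⊜ (Κ [] ⊗ (b ⊗ b))) P.refl (nm x) (dn x))) ,
              (λ x → cross (solve 2 (λ a b → (((a ⊗ b) ⊕ ((⊝ a) ⊗ b)) ⊗ Κ 1P) ⊜ (Κ [] ⊗ (b ⊗ b))) P.refl (nm x) (dn x)))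
          ; ⁻¹-cong = λ {x} {x′} → -K-cong {x} {x′}
          }
        ; comm = λ x y → cross (solve 4
            (λ a b c d → (((a ⊗ d) ⊕ (c ⊗ b)) ⊗ (d ⊗ b)) ⊜ (((c ⊗ b) ⊕ (a ⊗ d)) ⊗ (b ⊗ d)))
            P.refl (nm x) (dn x) (nm y) (dn y))
        }
      ; *-cong = λ {x} {x′} {y} {y′} → *K-cong {x} {x′} {y} {y′}
      ; *-assoc = λ x y z → cross (solve 6
          (λ a b c d e f → (((a ⊗ c) ⊗ e) ⊗ (b ⊗ (d ⊗ f))) ⊜ ((a ⊗ (c ⊗ e)) ⊗ ((b ⊗ d) ⊗ f)))
          P.refl (nm x) (dn x) (nm y) (dn y) (nm z) (dn z))
      ; *-identity =
          (λ x → cross (solve 2 (λ a b → ((Κ 1P ⊗ a) ⊗ b) ⊜ (a ⊗ (Κ 1P ⊗ b))) P.refl (nm x) (dn x))) ,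
          (λ x → cross (solve 2 (λ a b → ((a ⊗ Κ 1P) ⊗ b) ⊜ (a ⊗ (b ⊗ Κ 1P))) P.refl (nm x) (dn x)))
      ; distrib =
          (λ x y z → cross (solve 6
            (λ a b c d e f → ((a ⊗ ((c ⊗ f) ⊕ (e ⊗ d))) ⊗ ((b ⊗ d) ⊗ (b ⊗ f)))
                           ⊜ ((((a ⊗ c) ⊗ (b ⊗ f)) ⊕ ((a ⊗ e) ⊗ (b ⊗ d))) ⊗ (b ⊗ (d ⊗ f))))
            P.refl (nm x) (dn x) (nm y) (dn y) (nm z) (dn z))) ,
          (λ x y z → cross (solve 6
            (λ a b c d e f → ((((c ⊗ f) ⊕ (e ⊗ d)) ⊗ a) ⊗ ((d ⊗ b) ⊗ (f ⊗ b)))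
                           ⊜ ((((c ⊗ a) ⊗ (f ⊗ b)) ⊕ ((e ⊗ a) ⊗ (d ⊗ b))) ⊗ ((d ⊗ f) ⊗ b)))
            P.refl (nm x) (dn x) (nm y) (dn y) (nm z) (dn z)))
      }
    ; *-comm = λ x y → cross (solve 4
        (λ a b c d → ((a ⊗ c) ⊗ (d ⊗ b)) ⊜ ((c ⊗ a) ⊗ (b ⊗ d)))
        P.refl (nm x) (dn x) (nm y) (dn y))
    }

  ℚ⟨q⟩-commutativeRing : CommutativeRing 0ℓ 0ℓ
  ℚ⟨q⟩-commutativeRing = record { isCommutativeRing = ℚ⟨q⟩-isCommutativeRing }

  private module K = CommutativeRing ℚ⟨q⟩-commutativeRing
  open import Algebra.Properties.Semiring.Exp K.semiring using (_^_)

  ι-+ : ∀ p r → ι (p +P r) ≃ ι p +K ι r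
  ι-+ p r = cross (solve 2 (λ a b → ((a ⊕ b) ⊗ (Κ 1P ⊗ Κ 1P)) ⊜ (((a ⊗ Κ 1P) ⊕ (b ⊗ Κ 1P)) ⊗ Κ 1P)) P.refl p r)

  ι-* : ∀ p r → ι (p *P r) ≃ ι p *K ι r
  ι-* p r = cross (solve 2 (λ a b → ((a ⊗ b) ⊗ (Κ 1P ⊗ Κ 1P)) ⊜ ((a ⊗ b) ⊗ Κ 1P)) P.refl p r)

  ι-cong : ∀ {p r} → p ≋ r → ι p ≃ ι r
  ι-cong p≋r = cross (P.*-congʳ p≋r)

  q : ℚ⟨q⟩
  q = ι (qPow 1)

  ι-qPow : ∀ k → ι (qPow k) ≃ q ^ k
  ι-qPow zero    = K.refl
  ι-qPow (suc k) = begin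
    ι (qPow (suc k))        ≈⟨ ι-cong (qPow-suc k) ⟩
    ι (qPow 1 *P qPow k)    ≈⟨ ι-* (qPow 1) (qPow k) ⟩
    q *K ι (qPow k)         ≈⟨ K.*-congˡ {q} (ι-qPow k) ⟩
    q *K q ^ k              ∎
    where open import Relation.Binary.Reasoning.Setoid K.setoid

  -- qInt n is (1-q^ n) / (1-q^ 1) on the nose.
  [_]q : ℕ → ℚ⟨q⟩
  [ n ]q = qInt n , 1-q^suc-≉[] 0

  q^n≈1-[1-q][n]q : ∀ n → q ^ n ≃ 1K +K -K ((1K +K -K q) *K [ n ]q)
  q^n≈1-[1-q][n]q n = begin
    q ^ n                                      ≈⟨ ι-qPow n ⟨
    ι (qPow n)                                 ≈⟨ cross (solve 2  -- q^n (1 - q) = (1 - q) - (1 - q) (1 - q^n)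
      (λ a b → (b ⊗ ((Κ 1P ⊗ Κ 1P) ⊗ ((Κ 1P ⊗ Κ 1P) ⊗ (Κ 1P ⊕ (⊝ a)))))
             ⊜ (((Κ 1P ⊗ ((Κ 1P ⊗ Κ 1P) ⊗ (Κ 1P ⊕ (⊝ a))))
                 ⊕ ((⊝ (((Κ 1P ⊗ Κ 1P) ⊕ ((⊝ a) ⊗ Κ 1P)) ⊗ (Κ 1P ⊕ (⊝ b)))) ⊗ Κ 1P)) ⊗ Κ 1P))
      P.refl (qPow 1) (qPow n)) ⟩
    1K +K -K ((1K +K -K q) *K [ n ]q)          ∎
    where open import Relation.Binary.Reasoning.Setoid K.setoid

  1-q^w-invertible : ∀ w → 0 < w → ∃ λ g → g *K (1K +K -K (q ^ w)) ≃ 1K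
  1-q^w-invertible (suc w) _ = g , (begin
    g *K (1K +K -K (q ^ suc w))              ≈⟨ K.*-congˡ {g} (K.+-congˡ {1K} (K.-‿cong (K.sym (ι-qPow (suc w))))) ⟩
    g *K (1K +K -K (ι (qPow (suc w))))       ≈⟨ cross (solve 1 (λ b → ((Κ 1P ⊗ ((Κ 1P ⊗ Κ 1P) ⊕ ((⊝ b) ⊗ Κ 1P))) ⊗ Κ 1P)
                                                                ⊜ (Κ 1P ⊗ ((Κ 1P ⊕ (⊝ b)) ⊗ (Κ 1P ⊗ Κ 1P))))
                                                      P.refl (qPow (suc w))) ⟩
    1K                                       ∎)
    where open import Relation.Binary.Reasoning.Setoid K.setoid
          g : ℚ⟨q⟩
          g = 1P / (1-q^ suc w) , 1-q^suc-≉[] w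

  ≃0K⇒num≈P[] : ∀ x → x ≃ 0K → nm x ≈P []
  ≃0K⇒num≈P[] x (mk≃ eq) i = ≡.trans (≡.sym (*P-identityʳ (nm x) i)) (eq i)

  num≈P[]⇒≃0K : ∀ x → nm x ≈P [] → x ≃ 0K
  num≈P[]⇒≃0K x nm≈[] = mk≃ (λ i → ≡.trans (*P-identityʳ (nm x) i) (nm≈[] i))

  ℚ⟨q⟩-noZeroDivisors : ∀ a b → ¬ (a ≃ 0K) → a *K b ≃ 0K → b ≃ 0K
  ℚ⟨q⟩-noZeroDivisors a b a≄0 ab≃0 with ≈P[]? (nm b)
  ... | yes b≈[] = num≈P[]⇒≃0K b b≈[]
  ... | no  b≉[] = ⊥-elim (*P-≉[] (nm a) (nm b) (a≄0 ∘ num≈P[]⇒≃0K a) b≉[] (≃0K⇒num≈P[] (a *K b) ab≃0))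

  [suc]q-injective : ∀ {i j} → [ suc i ]q ≃ [ suc j ]q → i ≡ j
  [suc]q-injective {i} {j} (mk≃ eq) =
    1-q^suc-injective (*P-cancelʳ (1-q^ 1) (1-q^ suc i) (1-q^ suc j) (1-q^suc-≉[] 0) (mk≋ eq))

open ℚ[q]
open ℚ⟨q⟩
open Constraints using (_⊨*_; edges; isProper≡⊨*edges)
open Polynomial ℚ⟨q⟩-commutativeRing using (eval; coeff; agreeing⇒coeff≈)
open ColoringSums ℚ⟨q⟩-commutativeRing q using (χ)
open Sums (CommutativeRing.semiring ℚ⟨q⟩-commutativeRing) using (∑ₗ; ∑ₗ-cong; 𝟙)
open Interpolation ℚ⟨q⟩-commutativeRing using (χ-polynomial)
private module K = CommutativeRing ℚ⟨q⟩-commutativeRing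
open import Algebra.Properties.Semiring.Exp K.semiring using (_^_)

evalF-map-proj₁ : ∀ p x → evalF (map proj₁ p) (proj₁ x) ≡ proj₁ (eval p x)
evalF-map-proj₁ []      x = ≡.refl
evalF-map-proj₁ (a ∷ p) x = ≡.cong (λ e → proj₁ a +F (proj₁ x *F e)) (evalF-map-proj₁ p x)

coeffF-map-proj₁ : ∀ p i → coeffF (map proj₁ p) i ≡ proj₁ (coeff p i)
coeffF-map-proj₁ []      i       = ≡.refl
coeffF-map-proj₁ (a ∷ p) zero    = ≡.refl
coeffF-map-proj₁ (a ∷ p) (suc i) = coeffF-map-proj₁ p i

map-proj₁-toList : ∀ {Q} (valid : All ValidF Q) → map proj₁ (All.toList valid) ≡ Q
map-proj₁-toList []              = ≡.refl
map-proj₁-toList (valid ∷ valids) = ≡.cong (_ ∷_) (map-proj₁-toList valids)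

ι-sum : ∀ {A : Set} (h : A → PolyQ) xs → ι (foldr _+P_ [] (map h xs)) ≃ ∑ₗ xs (ι ∘ h)
ι-sum h []       = K.refl
ι-sum h (x ∷ xs) = K.trans (ι-+ (h x) _) (K.+-congˡ {ι (h x)} (ι-sum h xs))

ι-chiPoly : ∀ {v} (G : SimpleGraph v) wt n → ι (chiPoly G wt n) ≃ χ (edges G) wt n
ι-chiPoly {v} G wt n = K.trans (ι-sum _ (colorings v n)) (∑ₗ-cong (colorings v n) term)
  where
  ι-if : ∀ b k → ι (if b then qPow k else []) ≃ 𝟙 b *K q ^ k
  ι-if true  k = K.trans (ι-qPow k) (K.sym (K.*-identityˡ (q ^ k)))
  ι-if false k = K.sym (K.zeroˡ (q ^ k))
  term : ∀ c → ι (if isProper G c then qPow (weight wt c) else []) ≃ 𝟙 (c ⊨* edges G) *K q ^ weight wt c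
  term c = K.trans (ι-if (isProper G c) (weight wt c))
                   (K.*-congʳ {q ^ weight wt c} (K.reflexive (≡.cong 𝟙 (isProper≡⊨*edges G c))))

evalF-toList : ∀ {Q} (valid : All ValidF Q) x → evalF Q (proj₁ x) ≡ proj₁ (eval (All.toList valid) x)
evalF-toList valid x = ≡.trans (≡.cong (λ Q → evalF Q (proj₁ x)) (≡.sym (map-proj₁-toList valid)))
                               (evalF-map-proj₁ (All.toList valid) x)

coeffF-toList : ∀ {Q} (valid : All ValidF Q) i → coeffF Q i ≡ proj₁ (coeff (All.toList valid) i)
coeffF-toList valid i = ≡.trans (≡.cong (λ Q → coeffF Q i) (≡.sym (map-proj₁-toList valid)))
                                (coeffF-map-proj₁ (All.toList valid) i)

chromatic-interpolant : ∀ {v} (G : SimpleGraph v) wt → (∀ i → 0 < wt i) →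
                        ∃ λ P → ∀ n → eval P [ n ]q ≃ ι (chiPoly G wt n)
chromatic-interpolant {v} G wt wt>0 =
  let (P , P≃χ) = χ-polynomial q [_]q q^n≈1-[1-q][n]q 1-q^w-invertible v (edges G) wt wt>0
  in  P , λ n → K.trans (P≃χ n) (K.sym (ι-chiPoly G wt n))

theorem1 : ∀ {v : ℕ} (G : SimpleGraph v) (wt : Fin v → ℕ) → (∀ i → 0 < wt i) →
    Σ PolyF (λ P →
      All ValidF P ×
      (∀ n → 0 < n → evalF P (qInt n) ≈F chiF G wt n) ×
      (∀ (Q : PolyF) → All ValidF Q →
        (∀ n → 0 < n → evalF Q (qInt n) ≈F chiF G wt n) → Q ≈PF P))
theorem1 G wt wt>0 = map proj₁ P , All.fromList P , interpolates , unique
  where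
  P : List ℚ⟨q⟩
  P = proj₁ (chromatic-interpolant G wt wt>0)

  P≃χ : ∀ n → eval P [ n ]q ≃ ι (chiPoly G wt n)
  P≃χ = proj₂ (chromatic-interpolant G wt wt>0)

  interpolates : ∀ n → 0 < n → evalF (map proj₁ P) (qInt n) ≈F chiF G wt n
  interpolates n _ = ≡.subst (_≈F chiF G wt n) (≡.sym (evalF-map-proj₁ P [ n ]q))
                             (get≃ (P≃χ n))

  unique : ∀ Q → All ValidF Q → (∀ n → 0 < n → evalF Q (qInt n) ≈F chiF G wt n) → Q ≈PF map proj₁ P
  unique Q valid Q-interpolates i =
    ≡.subst₂ _≈F_ (≡.sym (coeffF-toList valid i)) (≡.sym (coeffF-map-proj₁ P i))
      (get≃ (agreeing⇒coeff≈ ℚ⟨q⟩-noZeroDivisors ([_]q ∘ suc) [suc]q-injective (All.toList valid) P agree i))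
    where
    agree : ∀ k → eval (All.toList valid) [ suc k ]q ≃ eval P [ suc k ]q
    agree k = K.trans {j = ι (chiPoly G wt (suc k))}
      (mk≃ (≡.subst (_≈F chiF G wt (suc k)) (evalF-toList valid [ suc k ]q) (Q-interpolates (suc k) ℕ.z<s)))
      (K.sym (P≃χ (suc k)))
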